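{- For every $n\ge1$, \[ F_{12}(n;q)=q^{n-1}F_{21}(n;q^{ -1})=(q-1)^{n+1}\sum_{j\ge1}(j-1)\,j^{n-1}q^{ -j}. \]
   Context: $\mathcal S_n$ is the set of permutations of $[n]$. For $\pi\in\mathcal S_n$ written in standard cycle form (each cycle begins with its smallest element, cycles ordered left to right by increasing smallest elements), $\mathrm{Flatten}(\pi)$ is the word obtained by erasing the parentheses. For a word $w_1\cdots w_n$, a descent is an index $i$ with $w_i>w_{i+1}$ and an ascent is an index $i$ with $w_i<w_{i+1}$. Define $F_{21}(n;q)=\sum_{\pi\in\mathcal S_n}q^{\mathrm{des}(\mathrm{Flatten}(\pi))}$ and $F_{12}(n;q)=\sum_{\pi\in\mathcal S_n}q^{\mathrm{asc}(\mathrm{Flatten}(\pi))}$, where $\mathrm{des}$ and $\mathrm{asc}$ count descents and ascents. The sum over $j$ is understood as a power series in $q^{ -1}$. -}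

module Defs where

open import Data.Nat as ℕ using (ℕ; zero; suc; _≡ᵇ_; _∸_; _^_)
open import Data.Integer as ℤ using (ℤ; +_; -[1+_])
open import Data.List using (List; []; _∷_; _++_; length; map; concatMap; upTo; foldr)
open import Data.Bool.ListAction using (any)
open import Data.Bool using (Bool; true; false; if_then_else_)

-- Permutations of [n] = {1,…,n} in one-line notation:
-- the list [π(1), …, π(n)].

insertAll : ℕ → List ℕ → List (List ℕ)
insertAll x [] = (x ∷ []) ∷ []
insertAll x (y ∷ ys) = (x ∷ y ∷ ys) ∷ map (y ∷_) (insertAll x ys)

S : ℕ → List (List ℕ)
S zero = [] ∷ []
S (suc n) = concatMap (insertAll (suc n)) (S n)

-- π(i) for a permutation in one-line notation (1-based; 0 if out of range)
app : List ℕ → ℕ → ℕ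
app [] _ = 0
app (x ∷ xs) zero = 0
app (x ∷ xs) (suc zero) = x
app (x ∷ xs) (suc (suc k)) = app xs (suc k)

cycleOf : ℕ → List ℕ → ℕ → ℕ → List ℕ
cycleOf zero π s c = []
cycleOf (suc f) π s c =
  c ∷ (if app π c ≡ᵇ s then [] else cycleOf f π s (app π c))

-- Flatten: write π in standard cycle form (each cycle starts with its
-- smallest element, cycles ordered by increasing smallest elements)
-- and erase the parentheses.
flattenGo : List ℕ → List ℕ → List ℕ → List ℕ
flattenGo π [] acc = acc
flattenGo π (i ∷ is) acc =
  if any (_≡ᵇ i) acc then flattenGo π is acc
  else flattenGo π is (acc ++ cycleOf (length π) π i i)

Flatten : List ℕ → List ℕ
Flatten π = flattenGo π (map suc (upTo (length π))) []

des : List ℕ → ℕ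
des [] = 0
des (x ∷ []) = 0
des (x ∷ y ∷ w) = (if y ℕ.<ᵇ x then 1 else 0) ℕ.+ des (y ∷ w)

asc : List ℕ → ℕ
asc [] = 0
asc (x ∷ []) = 0
asc (x ∷ y ∷ w) = (if x ℕ.<ᵇ y then 1 else 0) ℕ.+ asc (y ∷ w)

countWith : (List ℕ → ℕ) → ℕ → List (List ℕ) → ℕ
countWith st k = foldr (λ π c → (if st π ≡ᵇ k then 1 else 0) ℕ.+ c) 0

-- Laurent polynomials / Laurent series in q are represented by their
-- coefficient functions ℤ → ℤ  (e ↦ coefficient of q^e).

Coeffs : Set
Coeffs = ℤ → ℤ

F21 : ℕ → Coeffs
F21 n (+ k) = + countWith (λ π → des (Flatten π)) k (S n)
F21 n -[1+ k ] = + 0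

F12 : ℕ → Coeffs
F12 n (+ k) = + countWith (λ π → asc (Flatten π)) k (S n)
F12 n -[1+ k ] = + 0

-- q^d · p(q⁻¹):  coefficient of q^e is coefficient of q^(d-e) in p
qRecip : ℕ → Coeffs → Coeffs
qRecip d p e = p (+ d ℤ.- e)

-- polynomials in q as ascending coefficient lists
addP : List ℤ → List ℤ → List ℤ
addP [] q = q
addP (a ∷ p) [] = a ∷ p
addP (a ∷ p) (b ∷ q) = (a ℤ.+ b) ∷ addP p q

mulP : List ℤ → List ℤ → List ℤ
mulP [] q = []
mulP (a ∷ p) q = addP (map (a ℤ.*_) q) (+ 0 ∷ mulP p q)

powP : List ℤ → ℕ → List ℤ
powP p zero = + 1 ∷ []
powP p (suc k) = mulP p (powP p k)

qMinus1 : List ℤ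
qMinus1 = -[1+ 0 ] ∷ + 1 ∷ []

-- product of a polynomial (coefficient list) with a Laurent series:
-- coefficient of q^e is Σ_i p_i · s(e - i)  (a finite sum)
polyTimes : List ℤ → Coeffs → Coeffs
polyTimes [] s e = + 0
polyTimes (a ∷ p) s e = a ℤ.* s e ℤ.+ polyTimes p s (e ℤ.- + 1)

-- Σ_{j≥1} (j-1) j^{n-1} q^{-j}  as a power series in q⁻¹
Ser : ℕ → Coeffs
Ser n (+ k) = + 0
Ser n -[1+ k ] = + (k ℕ.* (suc k ^ (n ∸ 1)))   -- j = k+1

-- Write a(n, k) for the number of π ∈ S n whose flattened word has k ascents. Flatten π is a
-- permutation of [n], so asc + des = n - 1 on it, which is the first identity. Every permutation
-- of [n + 1] arises from a unique π ∈ S n by inserting n + 1 into its one-line notation. Inserted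
-- at the end, n + 1 is a new fixed point and is appended to Flatten π (one more ascent). Inserted
-- after the first p < n entries, it is spliced into the cycle of p + 1 of the permutation σ
-- obtained from π by moving its last entry to position p (a bijection of S n), so it lands right
-- after p + 1 in Flatten σ. Placing a new maximal letter after a letter that starts an ascent
-- keeps the ascent number and otherwise raises it by one; summing over σ and p gives
-- a(n + 1, k) = k a(n, k) + (n + 2 - k) a(n, k - 1). The coefficients of
-- (q - 1)^(n + 1) Σ_j (j - 1) j^(n - 1) q^(-j) obey the same recurrence, because passing from n
-- to n + 1 multiplies the series by the operator -q d/dq, and both sides agree for n = 1.

module Submission where

open import Defs
open import Data.Bool using (Bool; true; false; if_then_else_; T; _∨_)
import Data.Bool.Properties as Bool
open import Data.Bool.ListAction using (any)
open import Data.Empty using (⊥; ⊥-elim)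
open import Data.Integer using (ℤ)
open import Data.List using (List; []; _∷_; _++_; _∷ʳ_; length; map; concatMap; upTo; applyUpTo)
import Data.List.Properties as List
open import Data.List.Membership.Propositional using (_∈_; _∉_)
open import Data.List.Membership.Propositional.Properties
open import Data.List.Membership.Propositional.Properties.WithK using (unique∧set⇒bag)
open import Data.List.Relation.Binary.BagAndSetEquality using (∼bag⇒↭)
open import Data.List.Relation.Binary.Permutation.Propositional as ↭
  using (_↭_; prep; swap; ↭-refl; ↭-reflexive; ↭-sym; ↭-trans; ↭⇒↭ₛ)
open import Data.List.Relation.Binary.Permutation.Propositional.Properties
open import Data.List.Relation.Unary.All as All using (All; []; _∷_)
import Data.List.Relation.Unary.All.Properties as All
open import Data.List.Relation.Unary.AllPairs using ([]; _∷_)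
open import Data.List.Relation.Unary.Any using (here; there)
open import Data.List.Relation.Unary.Unique.Propositional using (Unique)
import Data.List.Relation.Unary.Unique.Propositional.Properties as Unique
open import Data.Nat using (ℕ; zero; suc; pred; >-nonZero; _≡ᵇ_; _<ᵇ_; _≤_; _<_; _≥_; z≤n; s≤s)
import Data.Nat.Properties as ℕ
open import Algebra.Properties.CommutativeSemigroup ℕ.*-commutativeSemigroup using () renaming (x∙yz≈y∙xz to x*[y*z]≡y*[x*z])
open import Algebra.Properties.CommutativeSemigroup ℕ.+-commutativeSemigroup using (interchange; x∙yz≈y∙xz)
open import Data.Product using (_×_; _,_; proj₁; proj₂; Σ-syntax)
open import Data.Sum using (_⊎_; inj₁; inj₂)
open import Data.Unit using (tt)
open import Function using (_∘_)
open import Function.Bundles using (mk⇔)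
open import Relation.Binary.PropositionalEquality
open import Data.List.Relation.Binary.Permutation.Setoid.Properties (setoid ℕ) using (Unique-resp-↭)

data EqView (m n : ℕ) : Set where
  equal    : m ≡ n → (m ≡ᵇ n) ≡ true  → EqView m n
  distinct : m ≢ n → (m ≡ᵇ n) ≡ false → EqView m n

eqView : ∀ m n → EqView m n
eqView m n with m ≡ᵇ n in e
... | true  = equal (ℕ.≡ᵇ⇒≡ m n (subst T (sym e) tt)) e
... | false = distinct (λ m≡n → subst T e (ℕ.≡⇒≡ᵇ m n m≡n)) e

≡⇒≡ᵇ-true : ∀ {m n} → m ≡ n → (m ≡ᵇ n) ≡ true
≡⇒≡ᵇ-true {m} {n} m≡n with eqView m n
... | equal _ e      = e
... | distinct m≢n _ = ⊥-elim (m≢n m≡n)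

≢⇒≡ᵇ-false : ∀ {m n} → m ≢ n → (m ≡ᵇ n) ≡ false
≢⇒≡ᵇ-false {m} {n} m≢n with eqView m n
... | equal m≡n _  = ⊥-elim (m≢n m≡n)
... | distinct _ e = e

≡ᵇ-refl : ∀ m → (m ≡ᵇ m) ≡ true
≡ᵇ-refl m = ≡⇒≡ᵇ-true {m} refl

data LtView (m n : ℕ) : Set where
  less    : m < n → (m <ᵇ n) ≡ true  → LtView m n
  notLess : n ≤ m → (m <ᵇ n) ≡ false → LtView m n

ltView : ∀ m n → LtView m n
ltView m n with m <ᵇ n in e
... | true  = less (ℕ.<ᵇ⇒< m n (subst T (sym e) tt)) e
... | false = notLess (ℕ.≮⇒≥ (λ m<n → subst T e (ℕ.<⇒<ᵇ m<n))) e

<⇒<ᵇ-true : ∀ {m n} → m < n → (m <ᵇ n) ≡ true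
<⇒<ᵇ-true {m} {n} m<n with ltView m n
... | less _ e      = e
... | notLess n≤m _ = ⊥-elim (ℕ.<⇒≱ m<n n≤m)

≥⇒<ᵇ-false : ∀ {m n} → n ≤ m → (m <ᵇ n) ≡ false
≥⇒<ᵇ-false {m} {n} n≤m with ltView m n
... | less m<n _  = ⊥-elim (ℕ.<⇒≱ m<n n≤m)
... | notLess _ e = e

Unique-map-injectiveOn : ∀ {A B : Set} (f : A → B) {xs : List A} → Unique xs →
  (∀ {x y} → x ∈ xs → y ∈ xs → f x ≡ f y → x ≡ y) → Unique (map f xs)
Unique-map-injectiveOn f []        inj = []
Unique-map-injectiveOn f (x∉ ∷ xs!) inj =
  All.map⁺ (All.tabulate (λ y∈ fx≡fy → All.lookup x∉ y∈ (inj (here refl) (there y∈) fx≡fy)))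
  ∷ Unique-map-injectiveOn f xs! (λ x∈ y∈ → inj (there x∈) (there y∈))

Unique-concatMap : ∀ {A B : Set} (f : A → List B) {xs : List A} → Unique xs →
  (∀ {x} → x ∈ xs → Unique (f x)) →
  (∀ {x y w} → x ∈ xs → y ∈ xs → w ∈ f x → w ∈ f y → x ≡ y) →
  Unique (concatMap f xs)
Unique-concatMap f []         f! disj = []
Unique-concatMap f {x ∷ xs} (x∉ ∷ xs!) f! disj =
  Unique.++⁺ (f! (here refl)) (Unique-concatMap f xs! (f! ∘ there) (λ x∈ y∈ → disj (there x∈) (there y∈)))
    λ (w∈fx , w∈rest) → separate w∈fx w∈rest
  where
  separate : ∀ {w} → w ∈ f x → w ∈ concatMap f xs → ⊥
  separate w∈fx w∈rest with ∈-concat⁻′ (map f xs) w∈rest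
  ... | _ , w∈fy , fy∈ with ∈-map⁻ f fy∈
  ... | y , y∈ , refl = All.lookup x∉ y∈ (disj (here refl) (there y∈) w∈fx w∈fy)

module Sums where
  open import Data.Nat using (_+_; _*_)

  𝟙 : Bool → ℕ
  𝟙 b = if b then 1 else 0

  ∑ : {A : Set} → (A → ℕ) → List A → ℕ
  ∑ f []       = 0
  ∑ f (x ∷ xs) = f x + ∑ f xs

  private variable A B : Set

  ∑-++ : ∀ (f : A → ℕ) xs ys → ∑ f (xs ++ ys) ≡ ∑ f xs + ∑ f ys
  ∑-++ f []       ys = refl
  ∑-++ f (x ∷ xs) ys = trans (cong (f x +_) (∑-++ f xs ys)) (sym (ℕ.+-assoc (f x) _ _))

  ∑-map : ∀ (f : B → ℕ) (g : A → B) xs → ∑ f (map g xs) ≡ ∑ (f ∘ g) xs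
  ∑-map f g []       = refl
  ∑-map f g (x ∷ xs) = cong (f (g x) +_) (∑-map f g xs)

  ∑-concatMap : ∀ (f : B → ℕ) (g : A → List B) xs →
                ∑ f (concatMap g xs) ≡ ∑ (∑ f ∘ g) xs
  ∑-concatMap f g []       = refl
  ∑-concatMap f g (x ∷ xs) =
    trans (∑-++ f (g x) (concatMap g xs)) (cong (∑ f (g x) +_) (∑-concatMap f g xs))

  ∑-↭ : ∀ (f : A → ℕ) {xs ys} → xs ↭ ys → ∑ f xs ≡ ∑ f ys
  ∑-↭ f ↭.refl         = refl
  ∑-↭ f (↭.prep x p)   = cong (f x +_) (∑-↭ f p)
  ∑-↭ f (↭.swap {ys = ys} x y p) =
    trans (cong (λ t → f x + (f y + t)) (∑-↭ f p)) (x∙yz≈y∙xz (f x) (f y) (∑ f ys))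
  ∑-↭ f (↭.trans p q)  = trans (∑-↭ f p) (∑-↭ f q)

  ∑-cong : ∀ {f g : A → ℕ} xs → (∀ {x} → x ∈ xs → f x ≡ g x) → ∑ f xs ≡ ∑ g xs
  ∑-cong []       f≗g = refl
  ∑-cong (x ∷ xs) f≗g = cong₂ _+_ (f≗g (here refl)) (∑-cong xs (f≗g ∘ there))

  ∑-+ : ∀ (f g : A → ℕ) xs → ∑ (λ x → f x + g x) xs ≡ ∑ f xs + ∑ g xs
  ∑-+ f g []       = refl
  ∑-+ f g (x ∷ xs) =
    trans (cong (f x + g x +_) (∑-+ f g xs)) (interchange (f x) (g x) (∑ f xs) (∑ g xs))

  ∑-*ˡ : ∀ c (f : A → ℕ) xs → ∑ (λ x → c * f x) xs ≡ c * ∑ f xs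
  ∑-*ˡ c f []       = sym (ℕ.*-zeroʳ c)
  ∑-*ˡ c f (x ∷ xs) = trans (cong (c * f x +_) (∑-*ˡ c f xs)) (sym (ℕ.*-distribˡ-+ c (f x) _))

  ∑-zero : ∀ {f : A → ℕ} xs → (∀ {x} → x ∈ xs → f x ≡ 0) → ∑ f xs ≡ 0
  ∑-zero []       f≗0 = refl
  ∑-zero (x ∷ xs) f≗0 = cong₂ _+_ (f≗0 (here refl)) (∑-zero xs (f≗0 ∘ there))

  ∑-comm : ∀ (h : A → B → ℕ) xs ys →
           ∑ (λ x → ∑ (h x) ys) xs ≡ ∑ (λ y → ∑ (λ x → h x y) xs) ys
  ∑-comm h []       ys = sym (∑-zero ys (λ _ → refl))
  ∑-comm h (x ∷ xs) ys = trans (cong (∑ (h x) ys +_) (∑-comm h xs ys))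
    (sym (∑-+ (h x) (λ y → ∑ (λ x → h x y) xs) ys))

  countWith≡∑ : ∀ (st : List ℕ → ℕ) k πs → countWith st k πs ≡ ∑ (λ π → 𝟙 (st π ≡ᵇ k)) πs
  countWith≡∑ st k []       = refl
  countWith≡∑ st k (π ∷ πs) = cong (𝟙 (st π ≡ᵇ k) +_) (countWith≡∑ st k πs)

module Permutations where

  oneTo : ℕ → List ℕ
  oneTo n = map suc (upTo n)

  oneTo-suc : ∀ n → oneTo (suc n) ≡ oneTo n ∷ʳ suc n
  oneTo-suc n = trans (cong (map suc) (sym (List.applyUpTo-∷ʳ (λ x → x) n)))
                      (List.map-++ suc (upTo n) (n ∷ []))

  length-oneTo : ∀ n → length (oneTo n) ≡ n
  length-oneTo n = trans (List.length-map suc (upTo n)) (List.length-upTo n)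

  oneTo-unique : ∀ n → Unique (oneTo n)
  oneTo-unique n = Unique.map⁺ ℕ.suc-injective (Unique.upTo⁺ n)

  InRange : ℕ → ℕ → Set
  InRange n x = 1 ≤ x × x ≤ n

  InRange-suc : ∀ {n x} → InRange n x → InRange (suc n) x
  InRange-suc (1≤x , x≤n) = 1≤x , ℕ.m≤n⇒m≤1+n x≤n

  InRange⇒≢suc : ∀ {n x} → InRange n x → x ≢ suc n
  InRange⇒≢suc (_ , x≤n) refl = ℕ.1+n≰n x≤n

  ∈-oneTo⁻ : ∀ {n x} → x ∈ oneTo n → InRange n x
  ∈-oneTo⁻ x∈ with ∈-map⁻ suc x∈
  ... | _ , y∈ , refl = s≤s z≤n , ∈-upTo⁻ y∈

  ∈-oneTo⁺ : ∀ {n x} → InRange n x → x ∈ oneTo n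
  ∈-oneTo⁺ {x = suc x} (_ , x<n) = ∈-map⁺ suc (∈-upTo⁺ x<n)

  suc∉oneTo : ∀ n → suc n ∉ oneTo n
  suc∉oneTo n suc∈ = InRange⇒≢suc (∈-oneTo⁻ suc∈) refl

  suc∷oneTo↭ : ∀ n → suc n ∷ oneTo n ↭ oneTo (suc n)
  suc∷oneTo↭ n = subst (suc n ∷ oneTo n ↭_) (sym (oneTo-suc n)) (∷↭∷ʳ (suc n) (oneTo n))

  insertAt : ℕ → ℕ → List ℕ → List ℕ
  insertAt zero    x ys       = x ∷ ys
  insertAt (suc p) x []       = x ∷ []
  insertAt (suc p) x (y ∷ ys) = y ∷ insertAt p x ys

  insertAll≡applyUpTo : ∀ x π → insertAll x π ≡ applyUpTo (λ p → insertAt p x π) (suc (length π))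
  insertAll≡applyUpTo x []       = refl
  insertAll≡applyUpTo x (y ∷ ys) = cong ((x ∷ y ∷ ys) ∷_)
    (trans (cong (map (y ∷_)) (insertAll≡applyUpTo x ys))
           (List.map-applyUpTo (λ p → insertAt p x ys) (y ∷_) (suc (length ys))))

  insertAt-↭ : ∀ p x ys → insertAt p x ys ↭ x ∷ ys
  insertAt-↭ zero    x ys       = ↭-refl
  insertAt-↭ (suc p) x []       = ↭-refl
  insertAt-↭ (suc p) x (y ∷ ys) = ↭-trans (prep y (insertAt-↭ p x ys)) (swap y x ↭-refl)

  length-insertAt : ∀ p x ys → length (insertAt p x ys) ≡ suc (length ys)
  length-insertAt p x ys = ↭-length (insertAt-↭ p x ys)

  ∈-insertAll⇒↭ : ∀ {w} x ys → w ∈ insertAll x ys → w ↭ x ∷ ys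
  ∈-insertAll⇒↭ x []       (here refl) = ↭-refl
  ∈-insertAll⇒↭ x (y ∷ ys) (here refl) = ↭-refl
  ∈-insertAll⇒↭ x (y ∷ ys) (there w∈) with ∈-map⁻ (y ∷_) w∈
  ... | _ , w′∈ , refl = ↭-trans (prep y (∈-insertAll⇒↭ x ys w′∈)) (swap y x ↭-refl)

  ++-∈-insertAll : ∀ as bs x → as ++ x ∷ bs ∈ insertAll x (as ++ bs)
  ++-∈-insertAll []       []       x = here refl
  ++-∈-insertAll []       (b ∷ bs) x = here refl
  ++-∈-insertAll (a ∷ as) bs       x = there (∈-map⁺ (a ∷_) (++-∈-insertAll as bs x))

  ∈S⇒↭ : ∀ n {π} → π ∈ S n → π ↭ oneTo n
  ∈S⇒↭ zero    (here refl) = ↭-refl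
  ∈S⇒↭ (suc n) π∈ with ∈-concat⁻′ (map (insertAll (suc n)) (S n)) π∈
  ... | _ , π∈ins , ins∈ with ∈-map⁻ (insertAll (suc n)) ins∈
  ... | σ , σ∈ , refl =
    ↭-trans (∈-insertAll⇒↭ (suc n) σ π∈ins) (↭-trans (prep (suc n) (∈S⇒↭ n σ∈)) (suc∷oneTo↭ n))

  ↭⇒∈S : ∀ n {π} → π ↭ oneTo n → π ∈ S n
  ↭⇒∈S zero    π↭ with ↭-empty-inv π↭
  ... | refl = here refl
  ↭⇒∈S (suc n) π↭ with ∈-∃++ (∈-resp-↭ (↭-sym π↭) (∈-oneTo⁺ (s≤s z≤n , ℕ.≤-refl)))
  ... | as , bs , refl =
    ∈-concat⁺′ (++-∈-insertAll as bs (suc n))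
      (∈-map⁺ (insertAll (suc n)) (↭⇒∈S n (drop-mid as [] (↭-trans π↭ (↭-sym (suc∷oneTo↭ n))))))

  length-∈S : ∀ n {π} → π ∈ S n → length π ≡ n
  length-∈S n π∈ = trans (↭-length (∈S⇒↭ n π∈)) (length-oneTo n)

  insertAll-unique : ∀ x ys → x ∉ ys → Unique (insertAll x ys)
  insertAll-unique x []       x∉ = [] ∷ []
  insertAll-unique x (y ∷ ys) x∉ =
    All.map⁺ (All.tabulate (λ _ eq → x∉ (here (List.∷-injectiveˡ eq))))
    ∷ Unique.map⁺ List.∷-injectiveʳ (insertAll-unique x ys (x∉ ∘ there))

  delete : ℕ → List ℕ → List ℕ
  delete x []       = []
  delete x (y ∷ ys) = if y ≡ᵇ x then ys else y ∷ delete x ys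

  delete-insertAll : ∀ {w} x ys → x ∉ ys → w ∈ insertAll x ys → delete x w ≡ ys
  delete-insertAll x []       x∉ (here refl) rewrite ≡ᵇ-refl x = refl
  delete-insertAll x (y ∷ ys) x∉ (here refl) rewrite ≡ᵇ-refl x = refl
  delete-insertAll x (y ∷ ys) x∉ (there w∈) with ∈-map⁻ (y ∷_) w∈
  ... | _ , w′∈ , refl rewrite ≢⇒≡ᵇ-false {y} {x} (λ y≡x → x∉ (here (sym y≡x))) =
    cong (y ∷_) (delete-insertAll x ys (x∉ ∘ there) w′∈)

  S-unique : ∀ n → Unique (S n)
  S-unique zero    = [] ∷ []
  S-unique (suc n) = Unique-concatMap (insertAll (suc n)) (S-unique n)
    (λ σ∈ → insertAll-unique (suc n) _ (fresh σ∈))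
    (λ {σ} {τ} σ∈ τ∈ w∈σ w∈τ → trans (sym (delete-insertAll (suc n) σ (fresh σ∈) w∈σ))
                                      (delete-insertAll (suc n) τ (fresh τ∈) w∈τ))
    where
    fresh : ∀ {σ} → σ ∈ S n → suc n ∉ σ
    fresh σ∈ suc∈ = suc∉oneTo n (∈-resp-↭ (∈S⇒↭ n σ∈) suc∈)

  ∈S-suc⁻ : ∀ n {π′} → π′ ∈ S (suc n) →
            Σ[ π ∈ List ℕ ] π ∈ S n × Σ[ p ∈ ℕ ] p ≤ n × π′ ≡ insertAt p (suc n) π
  ∈S-suc⁻ n π′∈ with ∈-concat⁻′ (map (insertAll (suc n)) (S n)) π′∈
  ... | _ , π′∈ins , ins∈ with ∈-map⁻ (insertAll (suc n)) ins∈
  ... | π , π∈ , refl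
    with ∈-applyUpTo⁻ (λ p → insertAt p (suc n) π) (subst (_ ∈_) (insertAll≡applyUpTo (suc n) π) π′∈ins)
  ... | p , p< , π′≡ = π , π∈ , p , ℕ.≤-pred (subst (λ l → p < suc l) (length-∈S n π∈) p<) , π′≡

  ∷ʳ-view : ∀ (π : List ℕ) → 1 ≤ length π → Σ[ α ∈ List ℕ ] Σ[ z ∈ ℕ ] π ≡ α ∷ʳ z
  ∷ʳ-view (x ∷ [])    _ = [] , x , refl
  ∷ʳ-view (x ∷ y ∷ π) _ with ∷ʳ-view (y ∷ π) (s≤s z≤n)
  ... | α , z , eq = x ∷ α , z , cong (x ∷_) eq

  length-∷ʳ : ∀ (α : List ℕ) z → length (α ∷ʳ z) ≡ suc (length α)
  length-∷ʳ []      z = refl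
  length-∷ʳ (a ∷ α) z = cong suc (length-∷ʳ α z)

  dropLast : List ℕ → List ℕ
  dropLast []          = []
  dropLast (x ∷ [])    = []
  dropLast (x ∷ y ∷ xs) = x ∷ dropLast (y ∷ xs)

  lastOrZero : List ℕ → ℕ
  lastOrZero []           = 0
  lastOrZero (x ∷ [])     = x
  lastOrZero (x ∷ y ∷ xs) = lastOrZero (y ∷ xs)

  dropLast-∷ʳ : ∀ α z → dropLast (α ∷ʳ z) ≡ α
  dropLast-∷ʳ []          z = refl
  dropLast-∷ʳ (a ∷ [])    z = refl
  dropLast-∷ʳ (a ∷ b ∷ α) z = cong (a ∷_) (dropLast-∷ʳ (b ∷ α) z)

  lastOrZero-∷ʳ : ∀ α z → lastOrZero (α ∷ʳ z) ≡ z
  lastOrZero-∷ʳ []          z = refl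
  lastOrZero-∷ʳ (a ∷ [])    z = refl
  lastOrZero-∷ʳ (a ∷ b ∷ α) z = lastOrZero-∷ʳ (b ∷ α) z

  rotate : ℕ → List ℕ → List ℕ
  rotate p π = insertAt p (lastOrZero π) (dropLast π)

  rotate-∷ʳ : ∀ p α z → rotate p (α ∷ʳ z) ≡ insertAt p z α
  rotate-∷ʳ p α z rewrite dropLast-∷ʳ α z | lastOrZero-∷ʳ α z = refl

  deleteAt : ℕ → List ℕ → List ℕ
  deleteAt p       []       = []
  deleteAt zero    (x ∷ xs) = xs
  deleteAt (suc p) (x ∷ xs) = x ∷ deleteAt p xs

  at : ℕ → List ℕ → ℕ
  at p       []       = 0
  at zero    (x ∷ xs) = x
  at (suc p) (x ∷ xs) = at p xs

  unrotate : ℕ → List ℕ → List ℕ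
  unrotate p σ = deleteAt p σ ∷ʳ at p σ

  deleteAt-insertAt : ∀ p z α → p ≤ length α → deleteAt p (insertAt p z α) ≡ α
  deleteAt-insertAt zero    z α       _         = refl
  deleteAt-insertAt (suc p) z (a ∷ α) (s≤s p≤) = cong (a ∷_) (deleteAt-insertAt p z α p≤)

  at-insertAt : ∀ p z α → p ≤ length α → at p (insertAt p z α) ≡ z
  at-insertAt zero    z α       _         = refl
  at-insertAt (suc p) z (a ∷ α) (s≤s p≤) = at-insertAt p z α p≤

  insertAt-deleteAt : ∀ p σ → p < length σ → insertAt p (at p σ) (deleteAt p σ) ≡ σ
  insertAt-deleteAt zero    (x ∷ σ)     _         = refl
  insertAt-deleteAt (suc p) (x ∷ y ∷ σ) (s≤s p<) = cong (x ∷_) (insertAt-deleteAt p (y ∷ σ) p<)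

  unrotate-rotate : ∀ p π → p < length π → unrotate p (rotate p π) ≡ π
  unrotate-rotate p π p< with ∷ʳ-view π (ℕ.≤-trans (s≤s z≤n) p<)
  ... | α , z , refl rewrite rotate-∷ʳ p α z =
    cong₂ _∷ʳ_ (deleteAt-insertAt p z α p≤α) (at-insertAt p z α p≤α)
    where
    p≤α : p ≤ length α
    p≤α = ℕ.≤-pred (subst (p <_) (length-∷ʳ α z) p<)

  rotate-unrotate : ∀ p σ → p < length σ → rotate p (unrotate p σ) ≡ σ
  rotate-unrotate p σ p< rewrite rotate-∷ʳ p (deleteAt p σ) (at p σ) = insertAt-deleteAt p σ p<

  rotate-↭ : ∀ p π → 1 ≤ length π → rotate p π ↭ π
  rotate-↭ p π 1≤ with ∷ʳ-view π 1≤
  ... | α , z , refl rewrite rotate-∷ʳ p α z = ↭-trans (insertAt-↭ p z α) (∷↭∷ʳ z α)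

  unrotate-↭ : ∀ p σ → p < length σ → unrotate p σ ↭ σ
  unrotate-↭ p σ p< = ↭-trans (↭-sym (∷↭∷ʳ (at p σ) (deleteAt p σ)))
    (↭-trans (↭-sym (insertAt-↭ p (at p σ) (deleteAt p σ))) (↭-reflexive (insertAt-deleteAt p σ p<)))

  rotate-∈S : ∀ n {π} p → 1 ≤ n → π ∈ S n → rotate p π ∈ S n
  rotate-∈S n p 1≤n π∈ =
    ↭⇒∈S n (↭-trans (rotate-↭ p _ (subst (1 ≤_) (sym (length-∈S n π∈)) 1≤n)) (∈S⇒↭ n π∈))

  map-rotate-↭ : ∀ n p → p < n → map (rotate p) (S n) ↭ S n
  map-rotate-↭ n p p<n = ∼bag⇒↭ (unique∧set⇒bag
      (Unique-map-injectiveOn (rotate p) (S-unique n) rotate-injectiveOn) (S-unique n) (mk⇔ to from))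
    where
    p<length : ∀ {π} → π ∈ S n → p < length π
    p<length π∈ = subst (p <_) (sym (length-∈S n π∈)) p<n
    rotate-injectiveOn : ∀ {π τ} → π ∈ S n → τ ∈ S n → rotate p π ≡ rotate p τ → π ≡ τ
    rotate-injectiveOn π∈ τ∈ eq = trans (sym (unrotate-rotate p _ (p<length π∈)))
      (trans (cong (unrotate p) eq) (unrotate-rotate p _ (p<length τ∈)))
    to : ∀ {σ} → σ ∈ map (rotate p) (S n) → σ ∈ S n
    to σ∈ with ∈-map⁻ (rotate p) σ∈
    ... | π , π∈ , refl = rotate-∈S n p (ℕ.≤-trans (s≤s z≤n) p<n) π∈
    from : ∀ {σ} → σ ∈ S n → σ ∈ map (rotate p) (S n)
    from {σ} σ∈ = subst (_∈ map (rotate p) (S n)) (rotate-unrotate p σ (p<length σ∈))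
      (∈-map⁺ (rotate p) (↭⇒∈S n (↭-trans (unrotate-↭ p σ (p<length σ∈)) (∈S⇒↭ n σ∈))))

module Flattening where
  open Permutations

  data MemView (j : ℕ) (xs : List ℕ) : Set where
    member    : j ∈ xs → any (_≡ᵇ j) xs ≡ true  → MemView j xs
    nonMember : j ∉ xs → any (_≡ᵇ j) xs ≡ false → MemView j xs

  any≡ᵇ⇒∈ : ∀ j xs → any (_≡ᵇ j) xs ≡ true → j ∈ xs
  any≡ᵇ⇒∈ j []       ()
  any≡ᵇ⇒∈ j (y ∷ xs) e with eqView y j
  ... | equal y≡j _   = here (sym y≡j)
  ... | distinct _ y≢ rewrite y≢ = there (any≡ᵇ⇒∈ j xs e)

  ∈⇒any≡ᵇ : ∀ {j} xs → j ∈ xs → any (_≡ᵇ j) xs ≡ true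
  ∈⇒any≡ᵇ (y ∷ xs) (here refl) rewrite ≡ᵇ-refl y = refl
  ∈⇒any≡ᵇ (y ∷ xs) (there j∈) rewrite ∈⇒any≡ᵇ xs j∈ = Bool.∨-zeroʳ _

  memView : ∀ j xs → MemView j xs
  memView j xs with any (_≡ᵇ j) xs in e
  ... | true  = member (any≡ᵇ⇒∈ j xs e) e
  ... | false = nonMember (λ j∈ → true≢false (trans (sym (∈⇒any≡ᵇ xs j∈)) e)) e
    where
    true≢false : true ≢ false
    true≢false ()

  ∉⇒any≡ᵇ-false : ∀ {j} xs → j ∉ xs → any (_≡ᵇ j) xs ≡ false
  ∉⇒any≡ᵇ-false {j} xs j∉ with memView j xs
  ... | member j∈ _   = ⊥-elim (j∉ j∈)
  ... | nonMember _ e = e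

  insertAfter : ℕ → ℕ → List ℕ → List ℕ
  insertAfter i x []       = []
  insertAfter i x (y ∷ ys) = if y ≡ᵇ i then y ∷ x ∷ ys else y ∷ insertAfter i x ys

  insertAfter-∉ : ∀ i x ys → i ∉ ys → insertAfter i x ys ≡ ys
  insertAfter-∉ i x []       i∉ = refl
  insertAfter-∉ i x (y ∷ ys) i∉ with eqView y i
  ... | equal y≡i _     = ⊥-elim (i∉ (here (sym y≡i)))
  ... | distinct _ y≢i rewrite y≢i = cong (y ∷_) (insertAfter-∉ i x ys (i∉ ∘ there))

  insertAfter-++ˡ : ∀ i x as bs → i ∈ as → insertAfter i x (as ++ bs) ≡ insertAfter i x as ++ bs
  insertAfter-++ˡ i x (a ∷ as) bs i∈ with eqView a i | i∈
  ... | equal _ a≡i     | _         rewrite a≡i = refl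
  ... | distinct a≢i _  | here i≡a  = ⊥-elim (a≢i (sym i≡a))
  ... | distinct _ a≢i  | there i∈′ rewrite a≢i = cong (a ∷_) (insertAfter-++ˡ i x as bs i∈′)

  insertAfter-++ʳ : ∀ i x as bs → i ∉ as → insertAfter i x (as ++ bs) ≡ as ++ insertAfter i x bs
  insertAfter-++ʳ i x []       bs i∉ = refl
  insertAfter-++ʳ i x (a ∷ as) bs i∉ with eqView a i
  ... | equal a≡i _     = ⊥-elim (i∉ (here (sym a≡i)))
  ... | distinct _ a≢i rewrite a≢i = cong (a ∷_) (insertAfter-++ʳ i x as bs (i∉ ∘ there))

  insertAfter-↭ : ∀ i x ys → i ∈ ys → insertAfter i x ys ↭ x ∷ ys
  insertAfter-↭ i x (y ∷ ys) i∈ with eqView y i | i∈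
  ... | equal _ y≡i    | _         rewrite y≡i = swap y x ↭-refl
  ... | distinct y≢i _ | here i≡y  = ⊥-elim (y≢i (sym i≡y))
  ... | distinct _ y≢i | there i∈′ rewrite y≢i =
    ↭-trans (prep y (insertAfter-↭ i x ys i∈′)) (swap y x ↭-refl)

  any-insertAfter : ∀ i x j ys → x ≢ j → any (_≡ᵇ j) (insertAfter i x ys) ≡ any (_≡ᵇ j) ys
  any-insertAfter i x j []       x≢j = refl
  any-insertAfter i x j (y ∷ ys) x≢j with eqView y i
  ... | equal _ y≡i    rewrite y≡i | ≢⇒≡ᵇ-false x≢j = refl
  ... | distinct _ y≢i rewrite y≢i = cong ((y ≡ᵇ j) ∨_) (any-insertAfter i x j ys x≢j)

  length-insertAfter : ∀ i x ys → length (insertAfter i x ys) ≤ suc (length ys)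
  length-insertAfter i x []       = z≤n
  length-insertAfter i x (y ∷ ys) with y ≡ᵇ i
  ... | true  = ℕ.≤-refl
  ... | false = s≤s (length-insertAfter i x ys)

  All-insertAfter : ∀ {P : ℕ → Set} i x ys → All P ys → P x → All P (insertAfter i x ys)
  All-insertAfter i x []       []         px = []
  All-insertAfter i x (y ∷ ys) (py ∷ pys) px with y ≡ᵇ i
  ... | true  = py ∷ px ∷ pys
  ... | false = py ∷ All-insertAfter i x ys pys px

  Unique-insertAfter : ∀ i x ys → Unique ys → x ∉ ys → Unique (insertAfter i x ys)
  Unique-insertAfter i x []       []         x∉ = []
  Unique-insertAfter i x (y ∷ ys) (y∉ ∷ ys!) x∉ with y ≡ᵇ i
  ... | true  = ((λ y≡x → x∉ (here (sym y≡x))) ∷ y∉)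
              ∷ All.tabulate (λ x′∈ x≡x′ → x∉ (there (subst (_∈ ys) (sym x≡x′) x′∈))) ∷ ys!
  ... | false = All-insertAfter i x ys y∉ (λ y≡x → x∉ (here (sym y≡x)))
              ∷ Unique-insertAfter i x ys ys! (x∉ ∘ there)

  data Walk (g : ℕ → ℕ) (s : ℕ) : ℕ → List ℕ → Set where
    stop : ∀ {c}   → g c ≡ s → Walk g s c (c ∷ [])
    step : ∀ {c w} → g c ≢ s → Walk g s (g c) w → Walk g s c (c ∷ w)

  Walk-head : ∀ {g s c w} → Walk g s c w → c ∈ w
  Walk-head (stop _)   = here refl
  Walk-head (step _ _) = here refl

  Walk⇒cycleOf : ∀ {π s c w} → Walk (app π) s c w → ∀ fuel → length w ≤ fuel → cycleOf fuel π s c ≡ w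
  Walk⇒cycleOf (stop πc≡s) (suc fuel) _ rewrite ≡⇒≡ᵇ-true πc≡s = refl
  Walk⇒cycleOf (step πc≢s walk) (suc fuel) (s≤s len≤) rewrite ≢⇒≡ᵇ-false πc≢s =
    cong (_ ∷_) (Walk⇒cycleOf walk fuel len≤)

  Walk-cong : ∀ {g f s c w} → Walk g s c w → (∀ {x} → x ∈ w → f x ≡ g x) → Walk f s c w
  Walk-cong (stop gc≡s) f≗g = stop (trans (f≗g (here refl)) gc≡s)
  Walk-cong {f = f} (step gc≢s walk) f≗g =
    step (gc≢s ∘ trans (sym (f≗g (here refl))))
         (subst (λ c → Walk f _ c _) (sym (f≗g (here refl))) (Walk-cong walk (f≗g ∘ there)))

  Walk-next : ∀ {g s c w x} → Walk g s c w → x ∈ w → g x ∈ w ⊎ g x ≡ s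
  Walk-next (stop gc≡s)         (here refl) = inj₂ gc≡s
  Walk-next (step _ walk)       (here refl) = inj₁ (there (Walk-head walk))
  Walk-next (step _ walk)       (there x∈) with Walk-next walk x∈
  ... | inj₁ gx∈ = inj₁ (there gx∈)
  ... | inj₂ gx≡s = inj₂ gx≡s

  Closed : (ℕ → ℕ) → List ℕ → Set
  Closed g A = ∀ {y} → y ∈ A → g y ∈ A

  Walk-reaches : ∀ {g s c w x A} → Walk g s c w → x ∈ w → Closed g A → x ∈ A → s ∈ A
  Walk-reaches (stop gc≡s)   (here refl) closed x∈A = subst (_∈ _) gc≡s (closed x∈A)
  Walk-reaches (step _ walk) (here refl) closed x∈A = Walk-reaches walk (Walk-head walk) closed (closed x∈A)
  Walk-reaches (step _ walk) (there x∈)  closed x∈A = Walk-reaches walk x∈ closed x∈A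

  Walk-insertAfter : ∀ {g f s c w} i x → Walk g s c w → Unique w → s ≢ x →
    f i ≡ x → f x ≡ g i → (∀ {y} → y ∈ w → y ≢ i → f y ≡ g y) →
    Walk f s c (insertAfter i x w)
  Walk-insertAfter {g} {f} {s} i x (stop {c} gc≡s) _ s≢x fi≡x fx≡gi f≗g with eqView c i
  ... | equal refl e rewrite e =
    step (λ fi≡s → s≢x (trans (sym fi≡s) fi≡x))
         (subst (λ c → Walk f s c (x ∷ [])) (sym fi≡x) (stop (trans fx≡gi gc≡s)))
  ... | distinct c≢i e rewrite e = stop (trans (f≗g (here refl) c≢i) gc≡s)
  Walk-insertAfter {g} {f} {s} i x (step {c} {w} gc≢s walk) (c∉ ∷ w!) s≢x fi≡x fx≡gi f≗g with eqView c i
  ... | equal refl e rewrite e =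
    step (λ fi≡s → s≢x (trans (sym fi≡s) fi≡x))
      (subst (λ c → Walk f s c (x ∷ w)) (sym fi≡x)
        (step (gc≢s ∘ trans (sym fx≡gi))
          (subst (λ c → Walk f s c w) (sym fx≡gi)
            (Walk-cong walk (λ y∈ → f≗g (there y∈) (All.lookup c∉ y∈ ∘ sym))))))
  ... | distinct c≢i e rewrite e =
    step (gc≢s ∘ trans (sym (f≗g (here refl) c≢i)))
      (subst (λ c → Walk f s c (insertAfter i x w)) (sym (f≗g (here refl) c≢i))
        (Walk-insertAfter i x walk w! s≢x fi≡x fx≡gi (f≗g ∘ there)))

  Walk-∷ʳ : ∀ {g f s c w} t → Walk g s c w → (∀ {x} → x ∈ w → f x ≡ g x) →
    (∀ {x} → x ∈ w → g x ≢ t) → s ≢ t → f s ≡ t → Walk f t c (w ∷ʳ s)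
  Walk-∷ʳ {f = f} t (stop gc≡s) f≗g _ s≢t fs≡t =
    step (s≢t ∘ trans (sym (trans (f≗g (here refl)) gc≡s)))
         (subst (λ c → Walk f t c _) (sym (trans (f≗g (here refl)) gc≡s)) (stop fs≡t))
  Walk-∷ʳ {f = f} {s} t (step {w = w} gc≢s walk) f≗g g≢t s≢t fs≡t =
    step (g≢t (here refl) ∘ trans (sym (f≗g (here refl))))
      (subst (λ c → Walk f t c (w ∷ʳ s)) (sym (f≗g (here refl)))
        (Walk-∷ʳ t walk (f≗g ∘ there) (g≢t ∘ there) s≢t fs≡t))

  record Cycle (n : ℕ) (g : ℕ → ℕ) (j : ℕ) : Set where
    constructor cycle
    field
      elems   : List ℕ
      walk    : Walk g j j elems
      unique  : Unique elems
      length≤ : length elems ≤ n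
      inRange : All (InRange n) elems

  open Cycle

  HasCycles : ℕ → (ℕ → ℕ) → Set
  HasCycles n g = ∀ {j} → InRange n j → Cycle n g j

  flattenGo-++ : ∀ π L₁ L₂ acc → flattenGo π (L₁ ++ L₂) acc ≡ flattenGo π L₂ (flattenGo π L₁ acc)
  flattenGo-++ π []       L₂ acc = refl
  flattenGo-++ π (i ∷ L₁) L₂ acc with any (_≡ᵇ i) acc
  ... | true  = flattenGo-++ π L₁ L₂ acc
  ... | false = flattenGo-++ π L₁ L₂ _

  flattenGo-⊇acc : ∀ π L acc {x} → x ∈ acc → x ∈ flattenGo π L acc
  flattenGo-⊇acc π []      acc x∈ = x∈
  flattenGo-⊇acc π (i ∷ L) acc x∈ with any (_≡ᵇ i) acc
  ... | true  = flattenGo-⊇acc π L acc x∈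
  ... | false = flattenGo-⊇acc π L _ (∈-++⁺ˡ x∈)

  flattenGo-⊇ : ∀ π k → length π ≡ suc k → ∀ L acc {j} → j ∈ L → j ∈ flattenGo π L acc
  flattenGo-⊇ π k len (i ∷ L) acc (here refl) with memView i acc
  ... | member i∈ e    rewrite e = flattenGo-⊇acc π L acc i∈
  ... | nonMember _ e rewrite e | len = flattenGo-⊇acc π L _ (∈-++⁺ʳ acc (here refl))
  flattenGo-⊇ π k len (i ∷ L) acc (there j∈) with any (_≡ᵇ i) acc
  ... | true  = flattenGo-⊇ π k len L acc j∈
  ... | false = flattenGo-⊇ π k len L _ j∈

  cycleOf-Cycle : ∀ {σ n j} → length σ ≡ n → (C : Cycle n (app σ) j) → cycleOf (length σ) σ j j ≡ elems C
  cycleOf-Cycle len C = Walk⇒cycleOf (walk C) _ (subst (_ ≤_) (sym len) (length≤ C))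

  flattenGo-inRange : ∀ {σ} {n} → length σ ≡ n → HasCycles n (app σ) →
    ∀ L acc → All (InRange n) L → All (InRange n) acc → All (InRange n) (flattenGo σ L acc)
  flattenGo-inRange len cyc []      acc []         acc∈ = acc∈
  flattenGo-inRange {σ} {n} len cyc (j ∷ L) acc (j∈ ∷ L∈) acc∈ with any (_≡ᵇ j) acc
  ... | true  = flattenGo-inRange len cyc L acc L∈ acc∈
  ... | false = subst (λ c → All (InRange n) (flattenGo σ L (acc ++ c))) (sym (cycleOf-Cycle len (cyc j∈)))
    (flattenGo-inRange len cyc L _ L∈ (All.++⁺ acc∈ (inRange (cyc j∈))))

  oneTo-inRange : ∀ n → All (InRange n) (oneTo n)
  oneTo-inRange n = All.tabulate ∈-oneTo⁻

  Flatten≡flattenGo : ∀ {π n} → length π ≡ n → Flatten π ≡ flattenGo π (oneTo n) []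
  Flatten≡flattenGo len = cong (λ m → flattenGo _ (oneTo m) []) len

  -- π′ is σ with n + 1 spliced into the cycle of i, right after i
  record IsSplice (σ π′ : List ℕ) (n i : ℕ) : Set where
    field
      lenσ  : length σ ≡ n
      lenπ′ : length π′ ≡ suc n
      i∈    : InRange n i
      π′i   : app π′ i ≡ suc n
      π′N   : app π′ (suc n) ≡ app σ i
      π′≗σ  : ∀ {x} → x ≤ n → x ≢ i → app π′ x ≡ app σ x

  module Splice {σ π′ n i} (spliced : IsSplice σ π′ n i) (cyc : HasCycles n (app σ)) where
    open IsSplice spliced

    private
      N : ℕ
      N = suc n

    walk′ : ∀ {j} (j∈ : InRange n j) → Walk (app π′) j j (insertAfter i N (elems (cyc j∈)))
    walk′ j∈ = Walk-insertAfter i N (walk C) (unique C) (InRange⇒≢suc j∈) π′i π′N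
                 (λ y∈ → π′≗σ (proj₂ (All.lookup (inRange C) y∈)))
      where C = cyc j∈

    length-cycle′ : ∀ {j} (j∈ : InRange n j) → length (insertAfter i N (elems (cyc j∈))) ≤ suc n
    length-cycle′ j∈ = ℕ.≤-trans (length-insertAfter i N (elems (cyc j∈))) (s≤s (length≤ (cyc j∈)))

    cycleOf-π′ : ∀ {j} (j∈ : InRange n j) → cycleOf (length π′) π′ j j ≡ insertAfter i N (elems (cyc j∈))
    cycleOf-π′ j∈ = Walk⇒cycleOf (walk′ j∈) (length π′)
      (subst (length (insertAfter i N (elems (cyc j∈))) ≤_) (sym lenπ′) (length-cycle′ j∈))

    Closed-++ : ∀ {j} (j∈ : InRange n j) {acc} → Closed (app σ) acc → Closed (app σ) (acc ++ elems (cyc j∈))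
    Closed-++ j∈ {acc} closed y∈ with ∈-++⁻ acc y∈
    ... | inj₁ y∈acc = ∈-++⁺ˡ (closed y∈acc)
    ... | inj₂ y∈C with Walk-next (walk (cyc j∈)) y∈C
    ...   | inj₁ σy∈C  = ∈-++⁺ʳ acc σy∈C
    ...   | inj₂ σy≡j = ∈-++⁺ʳ acc (subst (_∈ _) (sym σy≡j) (Walk-head (walk (cyc j∈))))

    -- a cycle disjoint from a σ-closed list cannot share i with it
    insertAfter-++-cycle : ∀ {j} (j∈ : InRange n j) {acc} → Closed (app σ) acc → j ∉ acc →
      insertAfter i N acc ++ insertAfter i N (elems (cyc j∈)) ≡ insertAfter i N (acc ++ elems (cyc j∈))
    insertAfter-++-cycle j∈ {acc} closed j∉ with memView i acc
    ... | member i∈acc _ =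
      trans (cong (insertAfter i N acc ++_) (insertAfter-∉ i N _ i∉C)) (sym (insertAfter-++ˡ i N acc _ i∈acc))
      where
      i∉C : i ∉ elems (cyc j∈)
      i∉C i∈C = j∉ (Walk-reaches (walk (cyc j∈)) i∈C closed i∈acc)
    ... | nonMember i∉acc _ =
      trans (cong (_++ _) (insertAfter-∉ i N acc i∉acc)) (sym (insertAfter-++ʳ i N acc _ i∉acc))

    flattenGo-splice : ∀ L acc → All (InRange n) L → Closed (app σ) acc →
      flattenGo π′ L (insertAfter i N acc) ≡ insertAfter i N (flattenGo σ L acc)
    flattenGo-splice []      acc []        closed = refl
    flattenGo-splice (j ∷ L) acc (j∈ ∷ L∈) closed
      rewrite any-insertAfter i N j acc (InRange⇒≢suc j∈ ∘ sym) with memView j acc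
    ... | member _ e rewrite e = flattenGo-splice L acc L∈ closed
    ... | nonMember j∉ e rewrite e =
      begin
        flattenGo π′ L (insertAfter i N acc ++ cycleOf (length π′) π′ j j)
      ≡⟨ cong (λ c → flattenGo π′ L (insertAfter i N acc ++ c)) (cycleOf-π′ j∈) ⟩
        flattenGo π′ L (insertAfter i N acc ++ insertAfter i N (elems (cyc j∈)))
      ≡⟨ cong (flattenGo π′ L) (insertAfter-++-cycle j∈ closed j∉) ⟩
        flattenGo π′ L (insertAfter i N (acc ++ elems (cyc j∈)))
      ≡⟨ flattenGo-splice L _ L∈ (Closed-++ j∈ closed) ⟩
        insertAfter i N (flattenGo σ L (acc ++ elems (cyc j∈)))
      ≡⟨ cong (λ c → insertAfter i N (flattenGo σ L (acc ++ c))) (sym (cycleOf-Cycle lenσ (cyc j∈))) ⟩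
        insertAfter i N (flattenGo σ L (acc ++ cycleOf (length σ) σ j j))
      ∎
      where open ≡-Reasoning

    Flatten-splice : Flatten π′ ≡ insertAfter i N (Flatten σ)
    Flatten-splice = begin
        Flatten π′
      ≡⟨ Flatten≡flattenGo lenπ′ ⟩
        flattenGo π′ (oneTo N) []
      ≡⟨ cong (λ L → flattenGo π′ L []) (oneTo-suc n) ⟩
        flattenGo π′ (oneTo n ++ N ∷ []) []
      ≡⟨ flattenGo-++ π′ (oneTo n) (N ∷ []) [] ⟩
        flattenGo π′ (N ∷ []) (flattenGo π′ (oneTo n) (insertAfter i N []))
      ≡⟨ cong (flattenGo π′ (N ∷ [])) (flattenGo-splice (oneTo n) [] (oneTo-inRange n) (λ ())) ⟩
        flattenGo π′ (N ∷ []) (insertAfter i N F)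
      ≡⟨ N-already-placed ⟩
        insertAfter i N F
      ≡⟨ cong (insertAfter i N) (sym (Flatten≡flattenGo lenσ)) ⟩
        insertAfter i N (Flatten σ)
      ∎
      where
      open ≡-Reasoning
      F = flattenGo σ (oneTo n) []
      i∈F : i ∈ F
      i∈F = flattenGo-⊇ σ (pred n) (trans lenσ (sym (ℕ.suc-pred n {{>-nonZero n>0}}))) (oneTo n) [] (∈-oneTo⁺ i∈)
        where n>0 = ℕ.≤-trans (proj₁ i∈) (proj₂ i∈)
      N-already-placed : flattenGo π′ (N ∷ []) (insertAfter i N F) ≡ insertAfter i N F
      N-already-placed rewrite ∈⇒any≡ᵇ _ (∈-resp-↭ (↭-sym (insertAfter-↭ i N F i∈F)) (here refl)) = refl

    private
      N-inRange : InRange N N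
      N-inRange = s≤s z≤n , ℕ.≤-refl

      N≢i : N ≢ i
      N≢i = InRange⇒≢suc i∈ ∘ sym

    cycleN : Cycle N (app π′) N
    cycleN with cyc i∈
    ... | cycle .(i ∷ []) (stop σi≡i) _ _ _ =
      cycle (N ∷ i ∷ [])
        (step π′N≢N (subst (λ c → Walk (app π′) N c (i ∷ [])) (sym (trans π′N σi≡i)) (stop π′i)))
        ((N≢i ∷ []) ∷ [] ∷ [])
        (s≤s (ℕ.≤-trans (proj₁ i∈) (proj₂ i∈)))
        (N-inRange ∷ InRange-suc i∈ ∷ [])
      where
      π′N≢N : app π′ N ≢ N
      π′N≢N π′N≡N = N≢i (trans (sym π′N≡N) (trans π′N σi≡i))
    ... | cycle .(i ∷ u) (step {w = u} σi≢i walkσ) (i∉u ∷ u!) len≤ (_ ∷ u∈) =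
      cycle (N ∷ (u ∷ʳ i))
        (step π′N≢N (subst (λ c → Walk (app π′) N c (u ∷ʳ i)) (sym π′N)
          (Walk-∷ʳ N walkσ (λ x∈ → π′≗σ (proj₂ (All.lookup u∈ x∈)) (λ x≡i → All.lookup i∉u x∈ (sym x≡i)))
                   (λ x∈ → InRange⇒≢suc (σ-inRange (there x∈))) (InRange⇒≢suc i∈) π′i)))
        (All.tabulate (λ x∈ N≡x → N∉ (subst (_∈ u ∷ʳ i) (sym N≡x) x∈))
          ∷ Unique.++⁺ u! ([] ∷ []) (λ { (i∈u , here refl) → All.lookup i∉u i∈u refl }))
        (s≤s (subst (_≤ n) (sym (length-∷ʳ u i)) len≤))
        (N-inRange ∷ All.++⁺ (All.map InRange-suc u∈) (InRange-suc i∈ ∷ []))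
      where
      σ-inRange : ∀ {x} → x ∈ i ∷ u → InRange n (app σ x)
      σ-inRange x∈ with Walk-next (step σi≢i walkσ) x∈
      ... | inj₁ (here σx≡i) = subst (InRange n) (sym σx≡i) i∈
      ... | inj₁ (there σx∈) = All.lookup u∈ σx∈
      ... | inj₂ σx≡i        = subst (InRange n) (sym σx≡i) i∈
      π′N≢N : app π′ N ≢ N
      π′N≢N π′N≡N = InRange⇒≢suc (σ-inRange (here refl)) (trans (sym π′N) π′N≡N)
      N∉ : N ∉ u ∷ʳ i
      N∉ N∈ with ∈-++⁻ u N∈
      ... | inj₁ N∈u       = InRange⇒≢suc (All.lookup u∈ N∈u) refl
      ... | inj₂ (here N≡i) = N≢i N≡i

    HasCycles-splice : HasCycles N (app π′)
    HasCycles-splice (1≤j , j≤N) with ℕ.m≤n⇒m<n∨m≡n j≤N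
    ... | inj₂ refl       = cycleN
    ... | inj₁ (s≤s j≤n) =
      cycle (insertAfter i N (elems C)) (walk′ j∈)
        (Unique-insertAfter i N _ (unique C) (λ N∈ → InRange⇒≢suc (All.lookup (inRange C) N∈) refl))
        (length-cycle′ j∈)
        (All-insertAfter i N _ (All.map InRange-suc (inRange C)) N-inRange)
      where
      j∈ : InRange n _
      j∈ = 1≤j , j≤n
      C = cyc j∈

  record IsExtension (σ π′ : List ℕ) (n : ℕ) : Set where
    field
      lenσ  : length σ ≡ n
      lenπ′ : length π′ ≡ suc n
      π′N   : app π′ (suc n) ≡ suc n
      π′≗σ  : ∀ {x} → x ≤ n → app π′ x ≡ app σ x

  module Extend {σ π′ n} (extended : IsExtension σ π′ n) (cyc : HasCycles n (app σ)) where
    open IsExtension extended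

    private
      N : ℕ
      N = suc n

    walk′ : ∀ {j} (j∈ : InRange n j) → Walk (app π′) j j (elems (cyc j∈))
    walk′ j∈ = Walk-cong (walk (cyc j∈)) (λ x∈ → π′≗σ (proj₂ (All.lookup (inRange (cyc j∈)) x∈)))

    flattenGo-extend : ∀ L acc → All (InRange n) L → flattenGo π′ L acc ≡ flattenGo σ L acc
    flattenGo-extend []      acc []        = refl
    flattenGo-extend (j ∷ L) acc (j∈ ∷ L∈) with any (_≡ᵇ j) acc
    ... | true  = flattenGo-extend L acc L∈
    ... | false =
      begin
        flattenGo π′ L (acc ++ cycleOf (length π′) π′ j j)
      ≡⟨ cong (λ c → flattenGo π′ L (acc ++ c)) (Walk⇒cycleOf (walk′ j∈) (length π′) len≤) ⟩
        flattenGo π′ L (acc ++ elems (cyc j∈))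
      ≡⟨ flattenGo-extend L _ L∈ ⟩
        flattenGo σ L (acc ++ elems (cyc j∈))
      ≡⟨ cong (λ c → flattenGo σ L (acc ++ c)) (sym (cycleOf-Cycle lenσ (cyc j∈))) ⟩
        flattenGo σ L (acc ++ cycleOf (length σ) σ j j)
      ∎
      where
      open ≡-Reasoning
      len≤ : length (elems (cyc j∈)) ≤ length π′
      len≤ = subst (length (elems (cyc j∈)) ≤_) (sym lenπ′) (ℕ.m≤n⇒m≤1+n (length≤ (cyc j∈)))

    Flatten-extend : Flatten π′ ≡ Flatten σ ∷ʳ N
    Flatten-extend = begin
        Flatten π′
      ≡⟨ Flatten≡flattenGo lenπ′ ⟩
        flattenGo π′ (oneTo N) []
      ≡⟨ cong (λ L → flattenGo π′ L []) (oneTo-suc n) ⟩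
        flattenGo π′ (oneTo n ++ N ∷ []) []
      ≡⟨ flattenGo-++ π′ (oneTo n) (N ∷ []) [] ⟩
        flattenGo π′ (N ∷ []) (flattenGo π′ (oneTo n) [])
      ≡⟨ cong (flattenGo π′ (N ∷ [])) (flattenGo-extend (oneTo n) [] (oneTo-inRange n)) ⟩
        flattenGo π′ (N ∷ []) F
      ≡⟨ N-new-cycle ⟩
        F ∷ʳ N
      ≡⟨ cong (_∷ʳ N) (sym (Flatten≡flattenGo lenσ)) ⟩
        Flatten σ ∷ʳ N
      ∎
      where
      open ≡-Reasoning
      F = flattenGo σ (oneTo n) []
      N∉F : N ∉ F
      N∉F N∈ = InRange⇒≢suc (All.lookup (flattenGo-inRange lenσ cyc (oneTo n) [] (oneTo-inRange n) []) N∈) refl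
      N-new-cycle : flattenGo π′ (N ∷ []) F ≡ F ∷ʳ N
      N-new-cycle rewrite ∉⇒any≡ᵇ-false F N∉F
        | Walk⇒cycleOf {π′} (stop π′N) (length π′) (subst (1 ≤_) (sym lenπ′) (s≤s z≤n)) = refl

    HasCycles-extend : HasCycles N (app π′)
    HasCycles-extend (1≤j , j≤N) with ℕ.m≤n⇒m<n∨m≡n j≤N
    ... | inj₂ refl       = cycle (N ∷ []) (stop π′N) ([] ∷ []) (s≤s z≤n) ((s≤s z≤n , ℕ.≤-refl) ∷ [])
    ... | inj₁ (s≤s j≤n) =
      cycle (elems C) (walk′ j∈) (unique C) (ℕ.m≤n⇒m≤1+n (length≤ C)) (All.map InRange-suc (inRange C))
      where
      j∈ : InRange n _
      j∈ = 1≤j , j≤n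
      C = cyc j∈

  app-insertAt : ∀ p y β → p ≤ length β → app (insertAt p y β) (suc p) ≡ y
  app-insertAt zero    y β       _        = refl
  app-insertAt (suc p) y (b ∷ β) (s≤s p≤) = app-insertAt p y β p≤

  app-insertAt-≢ : ∀ p y y′ β x → p ≤ length β → x ≢ suc p →
                   app (insertAt p y β) x ≡ app (insertAt p y′ β) x
  app-insertAt-≢ zero    y y′ β       zero          _        _  = refl
  app-insertAt-≢ (suc p) y y′ (b ∷ β) zero          _        _  = refl
  app-insertAt-≢ zero    y y′ β       (suc zero)    _        x≢ = ⊥-elim (x≢ refl)
  app-insertAt-≢ zero    y y′ []      (suc (suc x)) _        _  = refl
  app-insertAt-≢ zero    y y′ (b ∷ β) (suc (suc x)) _        _  = refl
  app-insertAt-≢ (suc p) y y′ (b ∷ β) (suc zero)    _        _  = refl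
  app-insertAt-≢ (suc p) y y′ (b ∷ β) (suc (suc x)) (s≤s p≤) x≢ =
    app-insertAt-≢ p y y′ β (suc x) p≤ (x≢ ∘ cong suc)

  app-∷ʳ : ∀ β z x → x ≤ length β → app (β ∷ʳ z) x ≡ app β x
  app-∷ʳ []      z zero          _        = refl
  app-∷ʳ (b ∷ β) z zero          _        = refl
  app-∷ʳ (b ∷ β) z (suc zero)    _        = refl
  app-∷ʳ (b ∷ β) z (suc (suc x)) (s≤s x≤) = app-∷ʳ β z (suc x) x≤

  app-∷ʳ-last : ∀ β z → app (β ∷ʳ z) (suc (length β)) ≡ z
  app-∷ʳ-last []      z = refl
  app-∷ʳ-last (b ∷ β) z = app-∷ʳ-last β z

  insertAt-∷ʳ : ∀ p y β z → p ≤ length β → insertAt p y (β ∷ʳ z) ≡ insertAt p y β ∷ʳ z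
  insertAt-∷ʳ zero    y β       z _        = refl
  insertAt-∷ʳ (suc p) y (b ∷ β) z (s≤s p≤) = cong (b ∷_) (insertAt-∷ʳ p y β z p≤)

  insertAt-length : ∀ y β → insertAt (length β) y β ≡ β ∷ʳ y
  insertAt-length y []      = refl
  insertAt-length y (b ∷ β) = cong (b ∷_) (insertAt-length y β)

  -- writing π = α ∷ʳ z, both permutations agree with insertAt p _ α ∷ʳ z
  -- away from the positions p + 1 and n + 1
  insertAt-IsSplice : ∀ {n π p} → π ∈ S n → p < n →
                      IsSplice (rotate p π) (insertAt p (suc n) π) n (suc p)
  insertAt-IsSplice {n} {π} {p} π∈ p<n
    with ∷ʳ-view π (subst (1 ≤_) (sym (length-∈S n π∈)) (ℕ.≤-trans (s≤s z≤n) p<n))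
  ... | α , z , refl = record
    { lenσ  = length-∈S n (rotate-∈S n p (ℕ.≤-trans (s≤s z≤n) p<n) π∈)
    ; lenπ′ = trans (length-insertAt p (suc n) (α ∷ʳ z)) (cong suc (length-∈S n π∈))
    ; i∈    = s≤s z≤n , p<n
    ; π′i   = begin
        app (insertAt p N (α ∷ʳ z)) (suc p)
      ≡⟨ cong (λ π′ → app π′ (suc p)) π′≡ ⟩
        app (insertAt p N α ∷ʳ z) (suc p)
      ≡⟨ app-∷ʳ (insertAt p N α) z (suc p) p+1≤ ⟩
        app (insertAt p N α) (suc p)
      ≡⟨ app-insertAt p N α p≤α ⟩
        N
      ∎
    ; π′N   = begin
        app (insertAt p N (α ∷ʳ z)) N
      ≡⟨ cong (λ π′ → app π′ N) π′≡ ⟩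
        app (insertAt p N α ∷ʳ z) N
      ≡⟨ cong (λ m → app (insertAt p N α ∷ʳ z) (suc m)) (sym length-insertAt-α) ⟩
        app (insertAt p N α ∷ʳ z) (suc (length (insertAt p N α)))
      ≡⟨ app-∷ʳ-last (insertAt p N α) z ⟩
        z
      ≡⟨ sym (app-insertAt p z α p≤α) ⟩
        app (insertAt p z α) (suc p)
      ≡⟨ cong (λ σ → app σ (suc p)) (sym (rotate-∷ʳ p α z)) ⟩
        app (rotate p (α ∷ʳ z)) (suc p)
      ∎
    ; π′≗σ  = λ {x} x≤n x≢ → begin
        app (insertAt p N (α ∷ʳ z)) x
      ≡⟨ cong (λ π′ → app π′ x) π′≡ ⟩
        app (insertAt p N α ∷ʳ z) x
      ≡⟨ app-∷ʳ (insertAt p N α) z x (subst (x ≤_) (sym length-insertAt-α) x≤n) ⟩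
        app (insertAt p N α) x
      ≡⟨ app-insertAt-≢ p N z α x p≤α x≢ ⟩
        app (insertAt p z α) x
      ≡⟨ cong (λ σ → app σ x) (sym (rotate-∷ʳ p α z)) ⟩
        app (rotate p (α ∷ʳ z)) x
      ∎
    }
    where
    open ≡-Reasoning
    N = suc n
    length-α : suc (length α) ≡ n
    length-α = trans (sym (length-∷ʳ α z)) (length-∈S n π∈)
    p≤α : p ≤ length α
    p≤α = ℕ.≤-pred (subst (p <_) (sym length-α) p<n)
    p+1≤ : suc p ≤ length (insertAt p N α)
    p+1≤ = subst (suc p ≤_) (sym (length-insertAt p N α)) (s≤s p≤α)
    length-insertAt-α : length (insertAt p N α) ≡ n
    length-insertAt-α = trans (length-insertAt p N α) length-α
    π′≡ : insertAt p N (α ∷ʳ z) ≡ insertAt p N α ∷ʳ z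
    π′≡ = insertAt-∷ʳ p N α z p≤α

  insertAt-IsExtension : ∀ {n π} → π ∈ S n → IsExtension π (insertAt n (suc n) π) n
  insertAt-IsExtension {n} {π} π∈ = subst (λ π′ → IsExtension π π′ n) (sym π′≡) (record
    { lenσ  = lenπ
    ; lenπ′ = trans (length-∷ʳ π (suc n)) (cong suc lenπ)
    ; π′N   = subst (λ m → app (π ∷ʳ suc n) (suc m) ≡ suc n) lenπ (app-∷ʳ-last π (suc n))
    ; π′≗σ  = λ {x} x≤n → app-∷ʳ π (suc n) x (subst (x ≤_) (sym lenπ) x≤n)
    })
    where
    lenπ : length π ≡ n
    lenπ = length-∈S n π∈
    π′≡ : insertAt n (suc n) π ≡ π ∷ʳ suc n
    π′≡ = trans (cong (λ m → insertAt m (suc n) π) (sym lenπ)) (insertAt-length (suc n) π)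

  ∈S⇒HasCycles : ∀ n {π} → π ∈ S n → HasCycles n (app π)
  ∈S⇒HasCycles zero    _   (1≤j , j≤0) = ⊥-elim (ℕ.<⇒≱ 1≤j j≤0)
  ∈S⇒HasCycles (suc n) π′∈ with ∈S-suc⁻ n π′∈
  ... | π , π∈ , p , p≤n , refl with ℕ.m≤n⇒m<n∨m≡n p≤n
  ...   | inj₁ p<n = Splice.HasCycles-splice (insertAt-IsSplice π∈ p<n)
                       (∈S⇒HasCycles n (rotate-∈S n p (ℕ.≤-trans (s≤s z≤n) p<n) π∈))
  ...   | inj₂ refl = Extend.HasCycles-extend (insertAt-IsExtension π∈) (∈S⇒HasCycles n π∈)

  Flatten-insertAt : ∀ {n π p} → π ∈ S n → p < n →
    Flatten (insertAt p (suc n) π) ≡ insertAfter (suc p) (suc n) (Flatten (rotate p π))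
  Flatten-insertAt {n} {π} {p} π∈ p<n = Splice.Flatten-splice (insertAt-IsSplice π∈ p<n)
    (∈S⇒HasCycles n (rotate-∈S n p (ℕ.≤-trans (s≤s z≤n) p<n) π∈))

  Flatten-insertAt-last : ∀ {n π} → π ∈ S n → Flatten (insertAt n (suc n) π) ≡ Flatten π ∷ʳ suc n
  Flatten-insertAt-last {n} π∈ = Extend.Flatten-extend (insertAt-IsExtension π∈) (∈S⇒HasCycles n π∈)

  Flatten-↭ : ∀ n {π} → π ∈ S n → Flatten π ↭ oneTo n
  Flatten-↭ zero    (here refl) = ↭-refl
  Flatten-↭ (suc n) π′∈ with ∈S-suc⁻ n π′∈
  ... | π , π∈ , p , p≤n , refl with ℕ.m≤n⇒m<n∨m≡n p≤n
  ...   | inj₁ p<n = ↭-trans (↭-reflexive (Flatten-insertAt π∈ p<n)) (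
    ↭-trans (insertAfter-↭ (suc p) (suc n) _ (∈-resp-↭ (↭-sym rotated↭) (∈-oneTo⁺ (s≤s z≤n , p<n))))
            (↭-trans (prep (suc n) rotated↭) (suc∷oneTo↭ n)))
    where
    rotated↭ : Flatten (rotate p π) ↭ oneTo n
    rotated↭ = Flatten-↭ n (rotate-∈S n p (ℕ.≤-trans (s≤s z≤n) p<n) π∈)
  ...   | inj₂ refl = ↭-trans (↭-reflexive (Flatten-insertAt-last π∈))
    (subst (Flatten π ∷ʳ suc n ↭_) (sym (oneTo-suc n)) (++⁺ʳ (suc n ∷ []) (Flatten-↭ n π∈)))

module Ascents where
  open import Data.Nat using (_+_; _*_; _∸_)
  open import Data.Nat.Tactic.RingSolver using (solve-∀)
  open Sums
  open Permutations
  open Flattening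

  -- the number of ascents gained by inserting a letter larger than all of w right after i
  ascentGain : ℕ → List ℕ → ℕ
  ascentGain i []          = 1
  ascentGain i (x ∷ [])    = 1
  ascentGain i (x ∷ y ∷ w) = if x ≡ᵇ i then (if x <ᵇ y then 0 else 1) else ascentGain i (y ∷ w)

  ascentGain≤1 : ∀ i w → ascentGain i w ≤ 1
  ascentGain≤1 i []          = ℕ.≤-refl
  ascentGain≤1 i (x ∷ [])    = ℕ.≤-refl
  ascentGain≤1 i (x ∷ y ∷ w) = if≤1 (x ≡ᵇ i) (x <ᵇ y) (ascentGain≤1 i (y ∷ w))
    where
    if≤1 : ∀ b c {d} → d ≤ 1 → (if b then (if c then 0 else 1) else d) ≤ 1
    if≤1 true  true  _   = z≤n
    if≤1 true  false _   = ℕ.≤-refl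
    if≤1 false _     d≤1 = d≤1

  insertAfter-∷ : ∀ i N y w → Σ[ r ∈ List ℕ ] insertAfter i N (y ∷ w) ≡ y ∷ r
  insertAfter-∷ i N y w with y ≡ᵇ i
  ... | true  = N ∷ w , refl
  ... | false = insertAfter i N w , refl

  asc-insertAfter : ∀ i N w → i ∈ w → All (_< N) w → asc (insertAfter i N w) ≡ ascentGain i w + asc w
  asc-insertAfter i N (x ∷ []) (here refl) (x<N ∷ []) rewrite ≡ᵇ-refl i | <⇒<ᵇ-true x<N = refl
  asc-insertAfter i N (x ∷ y ∷ w) i∈ (x<N ∷ y<N ∷ w<N) with eqView x i | i∈
  ... | equal refl e | _ rewrite e | <⇒<ᵇ-true x<N | ≥⇒<ᵇ-false (ℕ.<⇒≤ y<N) with x <ᵇ y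
  ...   | true  = refl
  ...   | false = refl
  asc-insertAfter i N (x ∷ y ∷ w) i∈ (x<N ∷ y<N ∷ w<N) | distinct x≢i _ | here i≡x = ⊥-elim (x≢i (sym i≡x))
  asc-insertAfter i N (x ∷ y ∷ w) i∈ (x<N ∷ y<N ∷ w<N) | distinct _ e | there i∈′
    rewrite e with insertAfter-∷ i N y w
  ... | r , eq rewrite eq = trans (cong (𝟙 (x <ᵇ y) +_) (trans (cong asc (sym eq)) ih))
                                 (x∙yz≈y∙xz (𝟙 (x <ᵇ y)) (ascentGain i (y ∷ w)) (asc (y ∷ w)))
    where ih = asc-insertAfter i N (y ∷ w) i∈′ (y<N ∷ w<N)

  noGain : ℕ → List ℕ → ℕ
  noGain i w = 𝟙 (ascentGain i w ≡ᵇ 0)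

  ∑-noGain : ∀ w → Unique w → ∑ (λ i → noGain i w) w ≡ asc w
  ∑-noGain []          _            = refl
  ∑-noGain (x ∷ [])    _            = refl
  ∑-noGain (x ∷ y ∷ w) (x∉ ∷ yw!) rewrite ≡ᵇ-refl x =
    cong₂ _+_ (ascent-at-x (x <ᵇ y))
              (trans (∑-cong (y ∷ w) (λ i∈ → cong (λ d → 𝟙 (d ≡ᵇ 0)) (skip-x i∈))) (∑-noGain (y ∷ w) yw!))
    where
    ascent-at-x : ∀ b → 𝟙 ((if b then 0 else 1) ≡ᵇ 0) ≡ 𝟙 b
    ascent-at-x true  = refl
    ascent-at-x false = refl
    skip-x : ∀ {i} → i ∈ y ∷ w → ascentGain i (x ∷ y ∷ w) ≡ ascentGain i (y ∷ w)
    skip-x i∈ rewrite ≢⇒≡ᵇ-false (All.lookup x∉ i∈) = refl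

  𝟙-split : ∀ d a k → d ≤ 1 →
            𝟙 (d + a ≡ᵇ k) ≡ 𝟙 (a ≡ᵇ k) * 𝟙 (d ≡ᵇ 0) + 𝟙 (suc a ≡ᵇ k) * (1 ∸ 𝟙 (d ≡ᵇ 0))
  𝟙-split zero       a k _ rewrite ℕ.*-identityʳ (𝟙 (a ≡ᵇ k)) | ℕ.*-zeroʳ (𝟙 (suc a ≡ᵇ k)) = sym (ℕ.+-identityʳ _)
  𝟙-split (suc zero) a k _ rewrite ℕ.*-identityʳ (𝟙 (suc a ≡ᵇ k)) | ℕ.*-zeroʳ (𝟙 (a ≡ᵇ k)) = refl
  𝟙-split (suc (suc d)) a k (s≤s ())

  𝟙≤1 : ∀ b → 𝟙 b ≤ 1
  𝟙≤1 true  = ℕ.≤-refl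
  𝟙≤1 false = z≤n

  ∑-complement : ∀ {A : Set} (b : A → ℕ) xs → (∀ x → b x ≤ 1) → ∑ (λ x → 1 ∸ b x) xs + ∑ b xs ≡ length xs
  ∑-complement b []       b≤1 = refl
  ∑-complement b (x ∷ xs) b≤1 =
    trans (interchange (1 ∸ b x) (∑ (λ x → 1 ∸ b x) xs) (b x) (∑ b xs))
          (cong₂ _+_ (ℕ.m∸n+n≡m (b≤1 x)) (∑-complement b xs b≤1))

  ∑-asc-insertAfter : ∀ n N k w → Unique w → All (_< N) w → length w ≡ n →
    ∑ (λ i → 𝟙 (asc (insertAfter i N w) ≡ᵇ k)) w ≡ 𝟙 (asc w ≡ᵇ k) * asc w + 𝟙 (suc (asc w) ≡ᵇ k) * (n ∸ asc w)
  ∑-asc-insertAfter n N k w w! w<N len = begin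
      ∑ (λ i → 𝟙 (asc (insertAfter i N w) ≡ᵇ k)) w
    ≡⟨ ∑-cong w (λ {i} i∈ → trans (cong (λ t → 𝟙 (t ≡ᵇ k)) (asc-insertAfter i N w i∈ w<N))
                                   (𝟙-split (ascentGain i w) a k (ascentGain≤1 i w))) ⟩
      ∑ (λ i → 𝟙 (a ≡ᵇ k) * noGain i w + 𝟙 (suc a ≡ᵇ k) * (1 ∸ noGain i w)) w
    ≡⟨ ∑-+ _ _ w ⟩
      ∑ (λ i → 𝟙 (a ≡ᵇ k) * noGain i w) w + ∑ (λ i → 𝟙 (suc a ≡ᵇ k) * (1 ∸ noGain i w)) w
    ≡⟨ cong₂ _+_ (∑-*ˡ (𝟙 (a ≡ᵇ k)) (λ i → noGain i w) w)
                 (∑-*ˡ (𝟙 (suc a ≡ᵇ k)) (λ i → 1 ∸ noGain i w) w) ⟩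
      𝟙 (a ≡ᵇ k) * ∑ (λ i → noGain i w) w + 𝟙 (suc a ≡ᵇ k) * ∑ (λ i → 1 ∸ noGain i w) w
    ≡⟨ cong₂ (λ s t → 𝟙 (a ≡ᵇ k) * s + 𝟙 (suc a ≡ᵇ k) * t) (∑-noGain w w!) gains ⟩
      𝟙 (a ≡ᵇ k) * a + 𝟙 (suc a ≡ᵇ k) * (n ∸ a)
    ∎
    where
    open ≡-Reasoning
    a = asc w
    gains : ∑ (λ i → 1 ∸ noGain i w) w ≡ n ∸ a
    gains = trans (sym (ℕ.m+n∸n≡m _ (∑ (λ i → noGain i w) w)))
      (cong₂ _∸_ (trans (∑-complement (λ i → noGain i w) w (λ i → 𝟙≤1 _)) len) (∑-noGain w w!))

  asc-∷ʳ : ∀ N w → 1 ≤ length w → All (_< N) w → asc (w ∷ʳ N) ≡ suc (asc w)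
  asc-∷ʳ N (x ∷ [])    _ (x<N ∷ []) rewrite <⇒<ᵇ-true x<N = refl
  asc-∷ʳ N (x ∷ y ∷ w) _ (_ ∷ yw<N) rewrite asc-∷ʳ N (y ∷ w) (s≤s z≤n) yw<N = ℕ.+-suc (𝟙 (x <ᵇ y)) _

  asc+des : ∀ w → Unique w → 1 ≤ length w → suc (asc w + des w) ≡ length w
  asc+des (x ∷ [])    _                  _ = refl
  asc+des (x ∷ y ∷ w) ((x≢y ∷ _) ∷ yw!) _ =
    cong suc (trans (interchange (𝟙 (x <ᵇ y)) (asc (y ∷ w)) (𝟙 (y <ᵇ x)) (des (y ∷ w)))
                    (trans (cong (_+ (asc (y ∷ w) + des (y ∷ w))) exactly-one) (asc+des (y ∷ w) yw! (s≤s z≤n))))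
    where
    exactly-one : 𝟙 (x <ᵇ y) + 𝟙 (y <ᵇ x) ≡ 1
    exactly-one with ltView x y | ltView y x
    ... | less x<y _    | less y<x _    = ⊥-elim (ℕ.<-asym x<y y<x)
    ... | less _ e₁     | notLess _ e₂  rewrite e₁ | e₂ = refl
    ... | notLess _ e₁  | less _ e₂     rewrite e₁ | e₂ = refl
    ... | notLess y≤x _ | notLess x≤y _ = ⊥-elim (x≢y (ℕ.≤-antisym x≤y y≤x))

  flatAsc flatDes : List ℕ → ℕ
  flatAsc π = asc (Flatten π)
  flatDes π = des (Flatten π)

  ascCount desCount : ℕ → ℕ → ℕ
  ascCount n k = countWith flatAsc k (S n)
  desCount n k = countWith flatDes k (S n)

  Flatten-unique : ∀ n {π} → π ∈ S n → Unique (Flatten π)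
  Flatten-unique n π∈ = Unique-resp-↭ (↭⇒↭ₛ (↭-sym (Flatten-↭ n π∈))) (oneTo-unique n)

  Flatten-< : ∀ n {π} → π ∈ S n → All (_< suc n) (Flatten π)
  Flatten-< n π∈ = All-resp-↭ (↭-sym (Flatten-↭ n π∈)) (All.map (s≤s ∘ proj₂) (oneTo-inRange n))

  length-Flatten : ∀ n {π} → π ∈ S n → length (Flatten π) ≡ n
  length-Flatten n π∈ = trans (↭-length (Flatten-↭ n π∈)) (length-oneTo n)

  flatAsc+flatDes : ∀ m {π} → π ∈ S (suc m) → flatAsc π + flatDes π ≡ m
  flatAsc+flatDes m π∈ = ℕ.suc-injective (trans
    (asc+des _ (Flatten-unique (suc m) π∈) (subst (1 ≤_) (sym (length-Flatten (suc m) π∈)) (s≤s z≤n)))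
    (length-Flatten (suc m) π∈))

  -- among the n + 1 insertions of n + 1 into a permutation whose flattened word has a ascents,
  -- the number producing k ascents
  insertions : ℕ → ℕ → ℕ → ℕ
  insertions n k a = 𝟙 (a ≡ᵇ k) * a + 𝟙 (suc a ≡ᵇ k) * (n ∸ a) + 𝟙 (suc a ≡ᵇ k)

  module Recurrence (m k : ℕ) where
    private
      n N : ℕ
      n = suc m
      N = suc n

      atK : List ℕ → ℕ
      atK w = 𝟙 (asc w ≡ᵇ k)

      G : ℕ → List ℕ → ℕ
      G p σ = atK (insertAfter (suc p) N (Flatten σ))

    count-insertAll : ∀ {π} → π ∈ S n →
      ∑ (atK ∘ Flatten) (insertAll N π) ≡ ∑ (λ p → G p (rotate p π)) (upTo n) + 𝟙 (suc (flatAsc π) ≡ᵇ k)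
    count-insertAll {π} π∈ = begin
        ∑ (atK ∘ Flatten) (insertAll N π)
      ≡⟨ cong (∑ (atK ∘ Flatten)) (trans (insertAll≡applyUpTo N π)
           (trans (cong (λ l → applyUpTo (λ p → insertAt p N π) (suc l)) (length-∈S n π∈))
                  (sym (List.map-upTo (λ p → insertAt p N π) N)))) ⟩
        ∑ (atK ∘ Flatten) (map (λ p → insertAt p N π) (upTo N))
      ≡⟨ ∑-map (atK ∘ Flatten) (λ p → insertAt p N π) (upTo N) ⟩
        ∑ h (upTo N)
      ≡⟨ cong (∑ h) (sym (List.applyUpTo-∷ʳ (λ x → x) n)) ⟩
        ∑ h (upTo n ∷ʳ n)
      ≡⟨ ∑-++ h (upTo n) (n ∷ []) ⟩
        ∑ h (upTo n) + (h n + 0)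
      ≡⟨ cong₂ _+_ (∑-cong (upTo n) (λ p∈ → cong atK (Flatten-insertAt π∈ (∈-upTo⁻ p∈))))
                   (trans (ℕ.+-identityʳ _) (cong atK (Flatten-insertAt-last π∈))) ⟩
        ∑ (λ p → G p (rotate p π)) (upTo n) + atK (Flatten π ∷ʳ N)
      ≡⟨ cong (λ a → ∑ (λ p → G p (rotate p π)) (upTo n) + 𝟙 (a ≡ᵇ k))
           (asc-∷ʳ N (Flatten π) (subst (1 ≤_) (sym (length-Flatten n π∈)) (s≤s z≤n)) (Flatten-< n π∈)) ⟩
        ∑ (λ p → G p (rotate p π)) (upTo n) + 𝟙 (suc (flatAsc π) ≡ᵇ k)
      ∎
      where
      open ≡-Reasoning
      h : ℕ → ℕ
      h p = atK (Flatten (insertAt p N π))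

    count-rotated : ∑ (λ π → ∑ (λ p → G p (rotate p π)) (upTo n)) (S n) ≡ ∑ (λ σ → ∑ (λ p → G p σ) (upTo n)) (S n)
    count-rotated = begin
        ∑ (λ π → ∑ (λ p → G p (rotate p π)) (upTo n)) (S n)
      ≡⟨ ∑-comm (λ π p → G p (rotate p π)) (S n) (upTo n) ⟩
        ∑ (λ p → ∑ (G p ∘ rotate p) (S n)) (upTo n)
      ≡⟨ ∑-cong (upTo n) (λ {p} p∈ → trans (sym (∑-map (G p) (rotate p) (S n)))
                                            (∑-↭ (G p) (map-rotate-↭ n p (∈-upTo⁻ p∈)))) ⟩
        ∑ (λ p → ∑ (G p) (S n)) (upTo n)
      ≡⟨ sym (∑-comm (λ σ p → G p σ) (S n) (upTo n)) ⟩
        ∑ (λ σ → ∑ (λ p → G p σ) (upTo n)) (S n)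
      ∎
      where open ≡-Reasoning

    count-insertAfter : ∀ {σ} → σ ∈ S n →
      ∑ (λ p → G p σ) (upTo n) ≡ 𝟙 (flatAsc σ ≡ᵇ k) * flatAsc σ + 𝟙 (suc (flatAsc σ) ≡ᵇ k) * (n ∸ flatAsc σ)
    count-insertAfter {σ} σ∈ = begin
        ∑ (λ p → G p σ) (upTo n)
      ≡⟨ sym (∑-map (λ i → atK (insertAfter i N (Flatten σ))) suc (upTo n)) ⟩
        ∑ (λ i → atK (insertAfter i N (Flatten σ))) (oneTo n)
      ≡⟨ ∑-↭ _ (↭-sym (Flatten-↭ n σ∈)) ⟩
        ∑ (λ i → atK (insertAfter i N (Flatten σ))) (Flatten σ)
      ≡⟨ ∑-asc-insertAfter n N k (Flatten σ) (Flatten-unique n σ∈) (Flatten-< n σ∈) (length-Flatten n σ∈) ⟩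
        𝟙 (flatAsc σ ≡ᵇ k) * flatAsc σ + 𝟙 (suc (flatAsc σ) ≡ᵇ k) * (n ∸ flatAsc σ)
      ∎
      where open ≡-Reasoning

    ascCount-suc : ascCount N k ≡ ∑ (insertions n k ∘ flatAsc) (S n)
    ascCount-suc = begin
        ascCount N k
      ≡⟨ countWith≡∑ flatAsc k (S N) ⟩
        ∑ (atK ∘ Flatten) (concatMap (insertAll N) (S n))
      ≡⟨ ∑-concatMap (atK ∘ Flatten) (insertAll N) (S n) ⟩
        ∑ (λ π → ∑ (atK ∘ Flatten) (insertAll N π)) (S n)
      ≡⟨ ∑-cong (S n) count-insertAll ⟩
        ∑ (λ π → ∑ (λ p → G p (rotate p π)) (upTo n) + 𝟙 (suc (flatAsc π) ≡ᵇ k)) (S n)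
      ≡⟨ ∑-+ _ _ (S n) ⟩
        ∑ (λ π → ∑ (λ p → G p (rotate p π)) (upTo n)) (S n) + ∑ (λ π → 𝟙 (suc (flatAsc π) ≡ᵇ k)) (S n)
      ≡⟨ cong (_+ ∑ (λ π → 𝟙 (suc (flatAsc π) ≡ᵇ k)) (S n)) (trans count-rotated (∑-cong (S n) count-insertAfter)) ⟩
        ∑ (λ σ → 𝟙 (flatAsc σ ≡ᵇ k) * flatAsc σ + 𝟙 (suc (flatAsc σ) ≡ᵇ k) * (n ∸ flatAsc σ)) (S n)
          + ∑ (λ π → 𝟙 (suc (flatAsc π) ≡ᵇ k)) (S n)
      ≡⟨ sym (∑-+ _ _ (S n)) ⟩
        ∑ (insertions n k ∘ flatAsc) (S n)
      ∎
      where open ≡-Reasoning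

  ascCount-zero : ∀ m → ascCount (suc (suc m)) 0 ≡ 0
  ascCount-zero m = trans (Recurrence.ascCount-suc m 0) (∑-zero (S (suc m)) (λ {σ} _ → none (flatAsc σ)))
    where
    none : ∀ a → insertions (suc m) 0 a ≡ 0
    none zero    = refl
    none (suc a) = refl

  𝟙-*-cong : ∀ a k (f : ℕ → ℕ) → 𝟙 (a ≡ᵇ k) * f a ≡ 𝟙 (a ≡ᵇ k) * f k
  𝟙-*-cong a k f with eqView a k
  ... | equal refl _ = refl
  ... | distinct _ e rewrite e = refl

  insertions-suc : ∀ m k a →
    insertions (suc m) (suc k) a ≡ suc k * 𝟙 (a ≡ᵇ suc k) + suc (suc m ∸ k) * 𝟙 (a ≡ᵇ k)
  insertions-suc m k a rewrite 𝟙-*-cong a (suc k) (λ x → x) | 𝟙-*-cong a k (suc m ∸_) =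
    ring (𝟙 (a ≡ᵇ suc k)) (𝟙 (a ≡ᵇ k)) (suc m ∸ k) (suc k)
    where
    ring : ∀ x y c K → x * K + y * c + y ≡ K * x + (1 + c) * y
    ring = solve-∀

  ascCount-recurrence : ∀ m k →
    ascCount (suc (suc m)) (suc k) ≡ suc k * ascCount (suc m) (suc k) + suc (suc m ∸ k) * ascCount (suc m) k
  ascCount-recurrence m k = begin
      ascCount (suc (suc m)) (suc k)
    ≡⟨ Recurrence.ascCount-suc m (suc k) ⟩
      ∑ (insertions (suc m) (suc k) ∘ flatAsc) (S (suc m))
    ≡⟨ ∑-cong (S (suc m)) (λ {σ} _ → insertions-suc m k (flatAsc σ)) ⟩
      ∑ (λ σ → suc k * atSucK σ + suc (suc m ∸ k) * atK σ) (S (suc m))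
    ≡⟨ ∑-+ _ _ (S (suc m)) ⟩
      ∑ (λ σ → suc k * atSucK σ) (S (suc m)) + ∑ (λ σ → suc (suc m ∸ k) * atK σ) (S (suc m))
    ≡⟨ cong₂ _+_ (∑-*ˡ (suc k) atSucK (S (suc m))) (∑-*ˡ (suc (suc m ∸ k)) atK (S (suc m))) ⟩
      suc k * ∑ atSucK (S (suc m)) + suc (suc m ∸ k) * ∑ atK (S (suc m))
    ≡⟨ sym (cong₂ (λ x y → suc k * x + suc (suc m ∸ k) * y) (countWith≡∑ flatAsc (suc k) (S (suc m)))
                                                             (countWith≡∑ flatAsc k (S (suc m)))) ⟩
      suc k * ascCount (suc m) (suc k) + suc (suc m ∸ k) * ascCount (suc m) k
    ∎
    where
    open ≡-Reasoning
    atK atSucK : List ℕ → ℕ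
    atK σ    = 𝟙 (flatAsc σ ≡ᵇ k)
    atSucK σ = 𝟙 (flatAsc σ ≡ᵇ suc k)

  ascCount-vanishes : ∀ m k → suc m ≤ k → ascCount (suc m) k ≡ 0
  ascCount-vanishes m k m<k = trans (countWith≡∑ flatAsc k (S (suc m)))
    (∑-zero (S (suc m)) (λ {π} π∈ → cong 𝟙 (≢⇒≡ᵇ-false {flatAsc π} (λ a≡k → ℕ.<⇒≱ m<k
      (subst (_≤ m) a≡k (subst (flatAsc π ≤_) (flatAsc+flatDes m π∈) (ℕ.m≤m+n (flatAsc π) (flatDes π))))))))

  desCount-vanishes : ∀ m k → suc m ≤ k → desCount (suc m) k ≡ 0
  desCount-vanishes m k m<k = trans (countWith≡∑ flatDes k (S (suc m)))
    (∑-zero (S (suc m)) (λ {π} π∈ → cong 𝟙 (≢⇒≡ᵇ-false {flatDes π} (λ d≡k → ℕ.<⇒≱ m<k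
      (subst (_≤ m) d≡k (subst (flatDes π ≤_) (flatAsc+flatDes m π∈) (ℕ.m≤n+m (flatDes π) (flatAsc π))))))))

  ≡ᵇ-complement : ∀ a d {m k} → a + d ≡ m → k ≤ m → (a ≡ᵇ k) ≡ (d ≡ᵇ m ∸ k)
  ≡ᵇ-complement a d {m} {k} a+d≡m k≤m with eqView a k
  ... | equal refl e   = trans e (sym (≡⇒≡ᵇ-true (trans (sym (ℕ.m+n∸m≡n a d)) (cong (_∸ a) a+d≡m))))
  ... | distinct a≢k e = trans e (sym (≢⇒≡ᵇ-false {d} (λ d≡m∸k → a≢k
      (trans (trans (sym (ℕ.m+n∸n≡m a d)) (cong (_∸ d) a+d≡m)) (trans (cong (m ∸_) d≡m∸k) (ℕ.m∸[m∸n]≡n k≤m))))))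

  ascCount≡desCount : ∀ m k → k ≤ m → ascCount (suc m) k ≡ desCount (suc m) (m ∸ k)
  ascCount≡desCount m k k≤m = begin
      ascCount (suc m) k
    ≡⟨ countWith≡∑ flatAsc k (S (suc m)) ⟩
      ∑ (λ π → 𝟙 (flatAsc π ≡ᵇ k)) (S (suc m))
    ≡⟨ ∑-cong (S (suc m)) (λ {π} π∈ →
         cong 𝟙 (≡ᵇ-complement (flatAsc π) (flatDes π) (flatAsc+flatDes m π∈) k≤m)) ⟩
      ∑ (λ π → 𝟙 (flatDes π ≡ᵇ m ∸ k)) (S (suc m))
    ≡⟨ sym (countWith≡∑ flatDes (m ∸ k) (S (suc m))) ⟩
      desCount (suc m) (m ∸ k)
    ∎
    where open ≡-Reasoning

module Series where
  open import Data.Nat using () renaming (_*_ to _*ℕ_; _^_ to _^ℕ_)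
  open import Data.Integer using (+_; -[1+_]; _+_; _*_; _-_; -_)
  import Data.Integer.Properties as ℤ
  open import Data.Integer.Tactic.RingSolver using (solve-∀)

  polyTimes-cong : ∀ {s t : Coeffs} → (∀ x → s x ≡ t x) → ∀ p e → polyTimes p s e ≡ polyTimes p t e
  polyTimes-cong s≗t []      e = refl
  polyTimes-cong s≗t (a ∷ p) e = cong₂ _+_ (cong (a *_) (s≗t e)) (polyTimes-cong s≗t p (e - + 1))

  polyTimes-addP : ∀ (s : Coeffs) p q e → polyTimes (addP p q) s e ≡ polyTimes p s e + polyTimes q s e
  polyTimes-addP s []      q       e = sym (ℤ.+-identityˡ _)
  polyTimes-addP s (a ∷ p) []      e = sym (ℤ.+-identityʳ _)
  polyTimes-addP s (a ∷ p) (b ∷ q) e rewrite polyTimes-addP s p q (e - + 1) =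
    ring a b (s e) (polyTimes p s (e - + 1)) (polyTimes q s (e - + 1))
    where
    ring : ∀ a b x y z → (a + b) * x + (y + z) ≡ a * x + y + (b * x + z)
    ring = solve-∀

  polyTimes-scale : ∀ (s : Coeffs) a q e → polyTimes (map (a *_) q) s e ≡ a * polyTimes q s e
  polyTimes-scale s a []      e = sym (ℤ.*-zeroʳ a)
  polyTimes-scale s a (b ∷ q) e rewrite polyTimes-scale s a q (e - + 1) =
    ring a b (s e) (polyTimes q s (e - + 1))
    where
    ring : ∀ a b x y → a * b * x + a * y ≡ a * (b * x + y)
    ring = solve-∀

  polyTimes-mulP : ∀ (s : Coeffs) p q e → polyTimes (mulP p q) s e ≡ polyTimes p (polyTimes q s) e
  polyTimes-mulP s []      q e = refl
  polyTimes-mulP s (a ∷ p) q e = begin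
      polyTimes (addP (map (a *_) q) (+ 0 ∷ mulP p q)) s e
    ≡⟨ polyTimes-addP s (map (a *_) q) (+ 0 ∷ mulP p q) e ⟩
      polyTimes (map (a *_) q) s e + (+ 0 * s e + polyTimes (mulP p q) s (e - + 1))
    ≡⟨ cong₂ _+_ (polyTimes-scale s a q e) (trans (ℤ.+-identityˡ _) (polyTimes-mulP s p q (e - + 1))) ⟩
      a * polyTimes q s e + polyTimes p (polyTimes q s) (e - + 1)
    ∎
    where open ≡-Reasoning

  polyTimes-neg : ∀ (s : Coeffs) p e → polyTimes p (λ x → - s x) e ≡ - polyTimes p s e
  polyTimes-neg s []      e = refl
  polyTimes-neg s (a ∷ p) e rewrite polyTimes-neg s p (e - + 1) = ring a (s e) (polyTimes p s (e - + 1))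
    where
    ring : ∀ a x y → a * (- x) + (- y) ≡ - (a * x + y)
    ring = solve-∀

  polyTimes-one : ∀ (s : Coeffs) e → polyTimes (powP qMinus1 0) s e ≡ s e
  polyTimes-one s e = ring (s e)
    where
    ring : ∀ y → + 1 * y + + 0 ≡ y
    ring = solve-∀

  polyTimes-qMinus1 : ∀ (s : Coeffs) e → polyTimes qMinus1 s e ≡ s (e - + 1) - s e
  polyTimes-qMinus1 s e = ring (s e) (s (e - + 1))
    where
    ring : ∀ x y → -[1+ 0 ] * x + (+ 1 * y + + 0) ≡ y - x
    ring = solve-∀

  -- derivTimes p s = (q p′(q)) · s
  derivTimes : List ℤ → Coeffs → Coeffs
  derivTimes []      s e = + 0
  derivTimes (a ∷ p) s e = polyTimes p s (e - + 1) + derivTimes p s (e - + 1)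

  derivTimes-addP : ∀ (s : Coeffs) p q e → derivTimes (addP p q) s e ≡ derivTimes p s e + derivTimes q s e
  derivTimes-addP s []      q       e = sym (ℤ.+-identityˡ _)
  derivTimes-addP s (a ∷ p) []      e = sym (ℤ.+-identityʳ _)
  derivTimes-addP s (a ∷ p) (b ∷ q) e rewrite polyTimes-addP s p q (e - + 1) | derivTimes-addP s p q (e - + 1) =
    ring (polyTimes p s (e - + 1)) (polyTimes q s (e - + 1)) (derivTimes p s (e - + 1)) (derivTimes q s (e - + 1))
    where
    ring : ∀ x y z w → x + y + (z + w) ≡ x + z + (y + w)
    ring = solve-∀

  derivTimes-scale : ∀ (s : Coeffs) a q e → derivTimes (map (a *_) q) s e ≡ a * derivTimes q s e
  derivTimes-scale s a []      e = sym (ℤ.*-zeroʳ a)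
  derivTimes-scale s a (b ∷ q) e rewrite polyTimes-scale s a q (e - + 1) | derivTimes-scale s a q (e - + 1) =
    sym (ℤ.*-distribˡ-+ a _ _)

  derivTimes-mulP : ∀ (s : Coeffs) p q e →
    derivTimes (mulP p q) s e ≡ polyTimes p (derivTimes q s) e + derivTimes p (polyTimes q s) e
  derivTimes-mulP s []      q e = refl
  derivTimes-mulP s (a ∷ p) q e
    rewrite derivTimes-addP s (map (a *_) q) (+ 0 ∷ mulP p q) e | derivTimes-scale s a q e
          | polyTimes-mulP s p q (e - + 1) | derivTimes-mulP s p q (e - + 1) =
    ring a (derivTimes q s e) (polyTimes p (polyTimes q s) (e - + 1))
         (polyTimes p (derivTimes q s) (e - + 1)) (derivTimes p (polyTimes q s) (e - + 1))
    where
    ring : ∀ a x y z w → a * x + (y + (z + w)) ≡ a * x + z + (y + w)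
    ring = solve-∀

  derivTimes-qMinus1 : ∀ (s : Coeffs) e → derivTimes qMinus1 s e ≡ s (e - + 1)
  derivTimes-qMinus1 s e = ring (s (e - + 1))
    where
    ring : ∀ y → + 1 * y + + 0 + (+ 0 + + 0) ≡ y
    ring = solve-∀

  derivTimes-powP : ∀ m (s : Coeffs) e →
    derivTimes (powP qMinus1 (suc m)) s e ≡ + suc m * polyTimes (powP qMinus1 m) s (e - + 1)
  derivTimes-powP zero s e
    rewrite derivTimes-mulP s qMinus1 (powP qMinus1 0) e | polyTimes-qMinus1 (derivTimes (powP qMinus1 0) s) e
          | derivTimes-qMinus1 (polyTimes (powP qMinus1 0) s) e =
    ring (polyTimes (powP qMinus1 0) s (e - + 1))
    where
    ring : ∀ y → + 0 - + 0 + y ≡ + 1 * y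
    ring = solve-∀
  derivTimes-powP (suc m) s e
    rewrite derivTimes-mulP s qMinus1 (powP qMinus1 (suc m)) e
          | polyTimes-qMinus1 (derivTimes (powP qMinus1 (suc m)) s) e
          | derivTimes-qMinus1 (polyTimes (powP qMinus1 (suc m)) s) e
          | derivTimes-powP m s (e - + 1) | derivTimes-powP m s e
          | polyTimes-mulP s qMinus1 (powP qMinus1 m) (e - + 1)
          | polyTimes-qMinus1 (polyTimes (powP qMinus1 m) s) (e - + 1) =
    ring (+ suc m) (polyTimes (powP qMinus1 m) s (e - + 1 - + 1)) (polyTimes (powP qMinus1 m) s (e - + 1))
    where
    ring : ∀ c a b → c * a - c * b + (a - b) ≡ (+ 1 + c) * (a - b)
    ring = solve-∀

  -- coefficientwise multiplication by the exponent, i.e. the operator q d/dq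
  euler : Coeffs → Coeffs
  euler s x = x * s x

  polyTimes-euler : ∀ (s : Coeffs) p e → polyTimes p (euler s) e ≡ e * polyTimes p s e - derivTimes p s e
  polyTimes-euler s []      e = ring e
    where
    ring : ∀ e → + 0 ≡ e * + 0 - + 0
    ring = solve-∀
  polyTimes-euler s (a ∷ p) e rewrite polyTimes-euler s p (e - + 1) =
    ring a e (s e) (polyTimes p s (e - + 1)) (derivTimes p s (e - + 1))
    where
    ring : ∀ a e x y w → a * (e * x) + ((e - + 1) * y - w) ≡ e * (a * x + y) - (y + w)
    ring = solve-∀

  Ser-suc : ∀ m x → Ser (suc (suc m)) x ≡ - euler (Ser (suc m)) x
  Ser-suc m (+ k)      = sym (cong -_ (ℤ.*-zeroʳ (+ k)))
  Ser-suc m -[1+ k ] = begin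
      + (k *ℕ (suc k ^ℕ suc m))
    ≡⟨ cong +_ (x*[y*z]≡y*[x*z] k (suc k) (suc k ^ℕ m)) ⟩
      + (suc k *ℕ (k *ℕ (suc k ^ℕ m)))
    ≡⟨ ℤ.pos-* (suc k) _ ⟩
      + suc k * + (k *ℕ (suc k ^ℕ m))
    ≡⟨ sym (ℤ.neg-distribˡ-* -[1+ k ] _) ⟩
      - (-[1+ k ] * + (k *ℕ (suc k ^ℕ m)))
    ∎
    where open ≡-Reasoning

  seriesSide : ℕ → Coeffs
  seriesSide n = polyTimes (powP qMinus1 (suc n)) (Ser n)

  seriesSide-recurrence : ∀ m e →
    seriesSide (suc (suc m)) e ≡ e * seriesSide (suc m) e + (+ suc (suc (suc m)) - e) * seriesSide (suc m) (e - + 1)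
  seriesSide-recurrence m e = begin
      polyTimes (mulP qMinus1 (powP qMinus1 (suc (suc m)))) (Ser (suc (suc m))) e
    ≡⟨ polyTimes-mulP _ qMinus1 (powP qMinus1 (suc (suc m))) e ⟩
      polyTimes qMinus1 X e
    ≡⟨ polyTimes-qMinus1 X e ⟩
      X (e - + 1) - X e
    ≡⟨ cong₂ _-_ (X≡ (e - + 1)) (X≡ e) ⟩
      - ((e - + 1) * R (e - + 1) - + suc n * U (e - + 1 - + 1)) - - (e * R e - + suc n * U (e - + 1))
    ≡⟨ cong (λ r → - ((e - + 1) * r - + suc n * U (e - + 1 - + 1)) - - (e * R e - + suc n * U (e - + 1))) R≡ ⟩
      - ((e - + 1) * (U (e - + 1 - + 1) - U (e - + 1)) - + suc n * U (e - + 1 - + 1)) - - (e * R e - + suc n * U (e - + 1))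
    ≡⟨ ring e (+ suc n) (R e) (U (e - + 1 - + 1)) (U (e - + 1)) ⟩
      e * R e + (+ suc (suc n) - e) * (U (e - + 1 - + 1) - U (e - + 1))
    ≡⟨ cong (λ r → e * R e + (+ suc (suc n) - e) * r) (sym R≡) ⟩
      e * R e + (+ suc (suc n) - e) * R (e - + 1)
    ∎
    where
    open ≡-Reasoning
    n = suc m
    R U X : Coeffs
    R = seriesSide n
    U = polyTimes (powP qMinus1 n) (Ser n)
    X = polyTimes (powP qMinus1 (suc n)) (Ser (suc n))
    ring : ∀ e c r u₂ u₁ → - ((e - + 1) * (u₂ - u₁) - c * u₂) - - (e * r - c * u₁)
                          ≡ e * r + ((+ 1 + c) - e) * (u₂ - u₁)
    ring = solve-∀
    R≡ : R (e - + 1) ≡ U (e - + 1 - + 1) - U (e - + 1)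
    R≡ = trans (polyTimes-mulP _ qMinus1 (powP qMinus1 n) (e - + 1)) (polyTimes-qMinus1 U (e - + 1))
    X≡ : ∀ x → X x ≡ - (x * R x - + suc n * U (x - + 1))
    X≡ x = begin
        X x
      ≡⟨ polyTimes-cong (Ser-suc m) (powP qMinus1 (suc n)) x ⟩
        polyTimes (powP qMinus1 (suc n)) (λ y → - euler (Ser n) y) x
      ≡⟨ polyTimes-neg (euler (Ser n)) (powP qMinus1 (suc n)) x ⟩
        - polyTimes (powP qMinus1 (suc n)) (euler (Ser n)) x
      ≡⟨ cong -_ (polyTimes-euler (Ser n) (powP qMinus1 (suc n)) x) ⟩
        - (x * R x - derivTimes (powP qMinus1 (suc n)) (Ser n) x)
      ≡⟨ cong (λ t → - (x * R x - t)) (derivTimes-powP n (Ser n) x) ⟩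
        - (x * R x - + suc n * U (x - + 1))
      ∎

  -[1+_]-1 : ∀ k → -[1+ k ] - + 1 ≡ -[1+ suc k ]
  -[1+ k ]-1 = cong (λ t → -[1+ suc t ]) (ℕ.+-identityʳ k)

  Δ² : ℤ → ℤ → ℤ → ℤ
  Δ² a b c = (Ser 1 a - Ser 1 b) - (Ser 1 b - Ser 1 c)

  seriesSide-one≡Δ² : ∀ e → seriesSide 1 e ≡ Δ² (e - + 1 - + 1) (e - + 1) e
  seriesSide-one≡Δ² e = begin
      polyTimes (mulP qMinus1 (powP qMinus1 1)) (Ser 1) e
    ≡⟨ polyTimes-mulP (Ser 1) qMinus1 (powP qMinus1 1) e ⟩
      polyTimes qMinus1 (polyTimes (powP qMinus1 1) (Ser 1)) e
    ≡⟨ polyTimes-qMinus1 (polyTimes (powP qMinus1 1) (Ser 1)) e ⟩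
      polyTimes (powP qMinus1 1) (Ser 1) (e - + 1) - polyTimes (powP qMinus1 1) (Ser 1) e
    ≡⟨ cong₂ _-_ (difference (e - + 1)) (difference e) ⟩
      Δ² (e - + 1 - + 1) (e - + 1) e
    ∎
    where
    open ≡-Reasoning
    difference : ∀ x → polyTimes (powP qMinus1 1) (Ser 1) x ≡ Ser 1 (x - + 1) - Ser 1 x
    difference x = trans (polyTimes-mulP (Ser 1) qMinus1 (powP qMinus1 0) x)
      (trans (polyTimes-qMinus1 (polyTimes (powP qMinus1 0) (Ser 1)) x)
             (cong₂ _-_ (polyTimes-one (Ser 1) (x - + 1)) (polyTimes-one (Ser 1) x)))

  -- for e ≥ 0 both sides are computed; for e < 0 the coefficients of Ser 1 are linear in e
  seriesSide-one : ∀ e → seriesSide 1 e ≡ F12 1 e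
  seriesSide-one (+ zero)        = seriesSide-one≡Δ² (+ 0)
  seriesSide-one (+ suc zero)    = seriesSide-one≡Δ² (+ 1)
  seriesSide-one (+ suc (suc k)) = seriesSide-one≡Δ² (+ suc (suc k))
  seriesSide-one -[1+ k ] = begin
      seriesSide 1 -[1+ k ]
    ≡⟨ seriesSide-one≡Δ² -[1+ k ] ⟩
      Δ² (-[1+ k ] - + 1 - + 1) (-[1+ k ] - + 1) -[1+ k ]
    ≡⟨ cong₂ (λ a b → Δ² a b -[1+ k ]) (trans (cong (_- + 1) (-[1+ k ]-1)) (-[1+ suc k ]-1)) (-[1+ k ]-1) ⟩
      Δ² -[1+ suc (suc k) ] -[1+ suc k ] -[1+ k ]
    ≡⟨ linear k ⟩
      + 0
    ∎
    where
    open ≡-Reasoning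
    linear : ∀ k → Δ² -[1+ suc (suc k) ] -[1+ suc k ] -[1+ k ] ≡ + 0
    linear k rewrite ℕ.*-identityʳ k = ring (+ k)
      where
      ring : ∀ x → ((+ 1 + (+ 1 + x)) - (+ 1 + x)) - ((+ 1 + x) - x) ≡ + 0
      ring = solve-∀

module Coefficients where
  open import Data.Nat using (_≟_) renaming (_+_ to _+ℕ_; _*_ to _*ℕ_; _∸_ to _∸ℕ_)
  open import Data.Integer using (+_; -[1+_]; _+_; _*_; _-_; -_; _⊖_)
  import Data.Integer.Properties as ℤ
  open import Relation.Nullary using (yes; no)
  open Ascents
  open Series

  F12-recurrence : ∀ m e →
    F12 (suc (suc m)) e ≡ e * F12 (suc m) e + (+ suc (suc (suc m)) - e) * F12 (suc m) (e - + 1)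
  F12-recurrence m -[1+ k ] = sym (cong₂ _+_ (ℤ.*-zeroʳ -[1+ k ]) (ℤ.*-zeroʳ (+ suc (suc (suc m)) - -[1+ k ])))
  F12-recurrence m (+ zero) = begin
      + ascCount (suc (suc m)) 0
    ≡⟨ cong +_ (ascCount-zero m) ⟩
      + 0
    ≡⟨ sym (cong₂ _+_ (ℤ.*-zeroˡ (F12 (suc m) (+ 0))) (ℤ.*-zeroʳ (+ suc (suc (suc m)) - + 0))) ⟩
      + 0 * F12 (suc m) (+ 0) + (+ suc (suc (suc m)) - + 0) * F12 (suc m) (+ 0 - + 1)
    ∎
    where open ≡-Reasoning
  F12-recurrence m (+ suc k) = begin
      + ascCount (suc (suc m)) (suc k)
    ≡⟨ cong +_ (ascCount-recurrence m k) ⟩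
      + (suc k *ℕ X +ℕ suc (suc m ∸ℕ k) *ℕ Y)
    ≡⟨ ℤ.pos-+ (suc k *ℕ X) (suc (suc m ∸ℕ k) *ℕ Y) ⟩
      + (suc k *ℕ X) + + (suc (suc m ∸ℕ k) *ℕ Y)
    ≡⟨ cong₂ _+_ (ℤ.pos-* (suc k) X) (trans (ℤ.pos-* (suc (suc m ∸ℕ k)) Y) coefficient) ⟩
      + suc k * + X + (+ suc (suc (suc m)) - + suc k) * + Y
    ∎
    where
    open ≡-Reasoning
    X = ascCount (suc m) (suc k)
    Y = ascCount (suc m) k
    -- when k > m + 1 the coefficients differ, but then Y = 0
    coefficient : + suc (suc m ∸ℕ k) * + Y ≡ (+ suc (suc (suc m)) - + suc k) * + Y
    coefficient with ℕ.≤-total k (suc m)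
    ... | inj₁ k≤1+m =
      cong (_* + Y) (sym (trans (ℤ.⊖-≥ (ℕ.m≤n⇒m≤1+n (s≤s k≤1+m))) (cong +_ (ℕ.+-∸-assoc 1 k≤1+m))))
    ... | inj₂ 1+m≤k = trans (times-Y≡0 (+ suc (suc m ∸ℕ k))) (sym (times-Y≡0 (+ suc (suc (suc m)) - + suc k)))
      where
      times-Y≡0 : ∀ c → c * + Y ≡ + 0
      times-Y≡0 c = trans (cong (λ y → c * + y) (ascCount-vanishes m k 1+m≤k)) (ℤ.*-zeroʳ c)

  F12≡seriesSide : ∀ m e → F12 (suc m) e ≡ seriesSide (suc m) e
  F12≡seriesSide zero    e = sym (seriesSide-one e)
  F12≡seriesSide (suc m) e = begin
      F12 (suc (suc m)) e
    ≡⟨ F12-recurrence m e ⟩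
      e * F12 (suc m) e + (+ suc (suc (suc m)) - e) * F12 (suc m) (e - + 1)
    ≡⟨ cong₂ (λ a b → e * a + (+ suc (suc (suc m)) - e) * b) (F12≡seriesSide m e) (F12≡seriesSide m (e - + 1)) ⟩
      e * seriesSide (suc m) e + (+ suc (suc (suc m)) - e) * seriesSide (suc m) (e - + 1)
    ≡⟨ sym (seriesSide-recurrence m e) ⟩
      seriesSide (suc (suc m)) e
    ∎
    where open ≡-Reasoning

  F12≡qRecip-F21 : ∀ m e → F12 (suc m) e ≡ qRecip m (F21 (suc m)) e
  F12≡qRecip-F21 m -[1+ k ] =
    sym (cong +_ (desCount-vanishes m (m +ℕ suc k) (subst (suc m ≤_) (sym (ℕ.+-suc m k)) (s≤s (ℕ.m≤m+n m k)))))
  F12≡qRecip-F21 m (+ k) rewrite ℤ.m-n≡m⊖n m k with ℕ.≤-total k m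
  ... | inj₁ k≤m rewrite ℤ.⊖-≥ k≤m = cong +_ (ascCount≡desCount m k k≤m)
  ... | inj₂ m≤k with k ≟ m
  ...   | yes refl rewrite ℤ.n⊖n≡0 k =
    cong +_ (trans (ascCount≡desCount k k ℕ.≤-refl) (cong (desCount (suc k)) (ℕ.n∸n≡0 k)))
  ...   | no k≢m = vanishing (ℕ.≤∧≢⇒< m≤k (k≢m ∘ sym))
    where
    vanishing : m < k → + ascCount (suc m) k ≡ F21 (suc m) (m ⊖ k)
    vanishing m<k rewrite ℤ.⊖-< m<k =
      trans (cong +_ (ascCount-vanishes m k m<k)) (sym (F21-negative (k ∸ℕ m) (ℕ.m<n⇒0<n∸m m<k)))
      where
      F21-negative : ∀ x → 1 ≤ x → F21 (suc m) (- + x) ≡ + 0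
      F21-negative (suc x) _ = refl

open import Data.Nat using (_+_; _∸_)
open Coefficients using (F12≡qRecip-F21; F12≡seriesSide)

corollary2p3 : (n : ℕ) → n ≥ 1 → (e : ℤ) →
    (F12 n e ≡ qRecip (n ∸ 1) (F21 n) e) ×
    (F12 n e ≡ polyTimes (powP qMinus1 (n + 1)) (Ser n) e)
corollary2p3 (suc m) _ e =
  F12≡qRecip-F21 m e ,
  trans (F12≡seriesSide m e) (cong (λ k → polyTimes (powP qMinus1 k) (Ser (suc m)) e) (ℕ.+-comm 1 (suc m)))
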